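{- The map sending a pair of bi-infinite paths $(u_i)_{i\in\mathbb{Z}}$, $(v_j)_{j\in\mathbb{Z}}$ in $\mathcal{T}$, with chosen normalisations $u_i=p_i/q_i$ and $v_j=r_j/s_j$, to the equivalence class of the matrix $(m_{i,j})_{i,j\in\mathbb{Z}}$, $m_{i,j}=p_is_j-q_ir_j$, provides a (well-defined) bijection between equivalence classes of tame $SL_2(\mathbb{Z}[\sigma])$-tilings and pairs of bi-infinite paths in $\mathcal{T}$ considered up to the simultaneous action of $SL_2(\mathbb{Z}[\sigma])$ on both paths.
   Context: Let $\sigma=e^{i\pi/3}$, $\mathbb{Z}[\sigma]$ the Eisenstein integers, $\widehat{\mathbb{Q}}(\sigma)=\mathbb{Q}(\sigma)\cup\{\infty\}$. A fraction $p/q$ ($p,q\in\mathbb{Z}[\sigma]$, not both zero) is irreducible if every common factor $k\in\mathbb{Z}[\sigma]$ of $p,q$ has $|k|=1$. $\mathcal{T}$ is the graph with vertex set $\widehat{\mathbb{Q}}(\sigma)$ in which points with irreducible representations $p/q$, $r/s$ are adjacent iff $|ps-rq|=1$ (the edges of the tiling of $\mathbb{H}^3$ by the images of the regular ideal tetrahedron with vertices $0,1,\sigma,\infty$ under its reflection group). A bi-infinite path is a sequence $(v_i)_{i\in\mathbb{Z}}$ of vertices with $v_i,v_{i+1}$ adjacent; a normalisation of it is a choice of irreducible fractions $v_i=p_i/q_i$ with $p_iq_{i+1}-p_{i+1}q_i=1$ for all $i$ (each path has exactly six normalisations, differing by multiplying $p_i,q_i$ by $\sigma^{(-1)^ik}$).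 $SL_2(\mathbb{Z}[\sigma])$ acts on $\widehat{\mathbb{Q}}(\sigma)$ by Möbius transformations, preserving $\mathcal{T}$. A bi-infinite matrix $(m_{i,j})$ over $\mathbb{Z}[\sigma]$ is an $SL_2(\mathbb{Z}[\sigma])$-tiling if $m_{i,j}m_{i+1,j+1}-m_{i,j+1}m_{i+1,j}=1$ for all $i,j$, and tame if all $3\times3$ determinants $\det(m_{i+a,j+b})_{a,b=0,1,2}$ vanish. Two tilings $(m_{i,j})$, $(m'_{i,j})$ are equivalent if there are integers $k,l$ with $m'_{i,j}=\sigma^{(-1)^ik+(-1)^jl}m_{i,j}$ for all $i,j$ (even rows multiplied by $\sigma^k$, odd rows by $\sigma^{ -k}$, even columns by $\sigma^l$, odd columns by $\sigma^{ -l}$). -}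

module Defs where

open import Data.Integer as ℤ using (ℤ; +_; -[1+_]; ∣_∣)
open import Data.Nat as ℕ using (ℕ; zero; suc)
open import Data.Product using (Σ; ∃; _×_; _,_)
open import Relation.Binary.PropositionalEquality using (_≡_)
import Data.Empty

-- Eisenstein integers ℤ[σ], σ = e^{iπ/3}, σ² = σ - 1.
-- eis a b represents a + b σ.

record 𝔼 : Set where
  constructor eis
  field
    re : ℤ
    im : ℤ

open 𝔼 public

infixl 6 _+ᴱ_ _-ᴱ_
infixl 7 _*ᴱ_

0ᴱ 1ᴱ σ σ⁻¹ : 𝔼
0ᴱ = eis (+ 0) (+ 0)
1ᴱ = eis (+ 1) (+ 0)
σ = eis (+ 0) (+ 1)
-- σ⁻¹ = conjugate of σ = 1 - σ
σ⁻¹ = eis (+ 1) (ℤ.- (+ 1))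

_+ᴱ_ : 𝔼 → 𝔼 → 𝔼
eis a b +ᴱ eis c d = eis (a ℤ.+ c) (b ℤ.+ d)

-ᴱ_ : 𝔼 → 𝔼
-ᴱ eis a b = eis (ℤ.- a) (ℤ.- b)

_-ᴱ_ : 𝔼 → 𝔼 → 𝔼
x -ᴱ y = x +ᴱ (-ᴱ y)

_*ᴱ_ : 𝔼 → 𝔼 → 𝔼
eis a b *ᴱ eis c d = eis (a ℤ.* c ℤ.- b ℤ.* d) (a ℤ.* d ℤ.+ b ℤ.* c ℤ.+ b ℤ.* d)

normᴱ : 𝔼 → ℤ
normᴱ (eis a b) = a ℤ.* a ℤ.+ a ℤ.* b ℤ.+ b ℤ.* b

IsUnit : 𝔼 → Set
IsUnit k = normᴱ k ≡ + 1

_∣ᴱ_ : 𝔼 → 𝔼 → Set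
k ∣ᴱ p = ∃ λ c → p ≡ k *ᴱ c

σ^ℕ : ℕ → 𝔼
σ^ℕ zero = 1ᴱ
σ^ℕ (suc n) = σ *ᴱ σ^ℕ n

σ⁻¹^ℕ : ℕ → 𝔼
σ⁻¹^ℕ zero = 1ᴱ
σ⁻¹^ℕ (suc n) = σ⁻¹ *ᴱ σ⁻¹^ℕ n

σ^ : ℤ → 𝔼
σ^ (+ n) = σ^ℕ n
σ^ (-[1+ n ]) = σ⁻¹^ℕ (suc n)

-- (-1)^i for i : ℤ
alt : ℕ → ℤ
alt zero = + 1
alt (suc n) = ℤ.- alt n

sgn : ℤ → ℤ
sgn i = alt ∣ i ∣

-- Points of ℚ̂(σ) = ℚ(σ) ∪ {∞}, as the projective line over ℚ(σ):
-- a pair (p , q) of Eisenstein integers, not both zero, standing for p/q;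
-- two points are equal (_≈ₚ_) iff p q' = p' q.

record Pt : Set where
  constructor pt
  field
    num : 𝔼
    den : 𝔼
    nonzero : (num ≡ 0ᴱ × den ≡ 0ᴱ) → Data.Empty.⊥

open Pt public

_≈ₚ_ : Pt → Pt → Set
x ≈ₚ y = num x *ᴱ den y ≡ num y *ᴱ den x

Irreducible : 𝔼 → 𝔼 → Set
Irreducible p q = ∀ k → k ∣ᴱ p → k ∣ᴱ q → IsUnit k

Rep : 𝔼 → 𝔼 → Pt → Set
Rep p q x = p *ᴱ den x ≡ num x *ᴱ q

IrrRep : 𝔼 → 𝔼 → Pt → Set
IrrRep p q x = Irreducible p q × Rep p q x

Adj : Pt → Pt → Set
Adj x y = Σ 𝔼 λ p → Σ 𝔼 λ q → Σ 𝔼 λ r → Σ 𝔼 λ s →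
  IrrRep p q x × IrrRep r s y × IsUnit (p *ᴱ s -ᴱ r *ᴱ q)

record Path : Set where
  field
    vtx : ℤ → Pt
    adj : ∀ i → Adj (vtx i) (vtx (i ℤ.+ + 1))

open Path public

record Normalisation (γ : Path) : Set where
  field
    nm : ℤ → 𝔼
    dn : ℤ → 𝔼
    irrep : ∀ i → IrrRep (nm i) (dn i) (vtx γ i)
    unimod : ∀ i → nm i *ᴱ dn (i ℤ.+ + 1) -ᴱ nm (i ℤ.+ + 1) *ᴱ dn i ≡ 1ᴱ

open Normalisation public

record SL₂ : Set where
  field
    a b c d : 𝔼
    det1 : a *ᴱ d -ᴱ b *ᴱ c ≡ 1ᴱ

open SL₂ public

-- g · x ≈ y, where g · (p/q) = (a p + b q)/(c p + d q)
Maps : SL₂ → Pt → Pt → Set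
Maps g x y =
  (a g *ᴱ num x +ᴱ b g *ᴱ den x) *ᴱ den y ≡ num y *ᴱ (c g *ᴱ num x +ᴱ d g *ᴱ den x)

Mat : Set
Mat = ℤ → ℤ → 𝔼

IsSL₂Tiling : Mat → Set
IsSL₂Tiling m = ∀ i j →
  m i j *ᴱ m (i ℤ.+ + 1) (j ℤ.+ + 1) -ᴱ m i (j ℤ.+ + 1) *ᴱ m (i ℤ.+ + 1) j ≡ 1ᴱ

det3 : (x₀₀ x₀₁ x₀₂ x₁₀ x₁₁ x₁₂ x₂₀ x₂₁ x₂₂ : 𝔼) → 𝔼
det3 x₀₀ x₀₁ x₀₂ x₁₀ x₁₁ x₁₂ x₂₀ x₂₁ x₂₂ =
  x₀₀ *ᴱ (x₁₁ *ᴱ x₂₂ -ᴱ x₁₂ *ᴱ x₂₁)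
  -ᴱ x₀₁ *ᴱ (x₁₀ *ᴱ x₂₂ -ᴱ x₁₂ *ᴱ x₂₀)
  +ᴱ x₀₂ *ᴱ (x₁₀ *ᴱ x₂₁ -ᴱ x₁₁ *ᴱ x₂₀)

IsTame : Mat → Set
IsTame m = ∀ i j →
  det3 (m i j)              (m i (j ℤ.+ + 1))              (m i (j ℤ.+ + 2))
       (m (i ℤ.+ + 1) j)    (m (i ℤ.+ + 1) (j ℤ.+ + 1))    (m (i ℤ.+ + 1) (j ℤ.+ + 2))
       (m (i ℤ.+ + 2) j)    (m (i ℤ.+ + 2) (j ℤ.+ + 1))    (m (i ℤ.+ + 2) (j ℤ.+ + 2))
  ≡ 0ᴱ

TameTiling : Mat → Set
TameTiling m = IsSL₂Tiling m × IsTame m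

TilingEquiv : Mat → Mat → Set
TilingEquiv m m' = Σ ℤ λ k → Σ ℤ λ l → ∀ i j →
  m' i j ≡ σ^ (sgn i ℤ.* k ℤ.+ sgn j ℤ.* l) *ᴱ m i j

tilingOf : ∀ {u v : Path} → Normalisation u → Normalisation v → Mat
tilingOf nu nv i j = nm nu i *ᴱ dn nv j -ᴱ dn nu i *ᴱ nm nv j

{-# OPTIONS --safe #-}
module Submission where

-- Write x i = (p i , q i) and w j = (r j , s j), so that m i j = x i ∧ w j for the determinant pairing
-- ∧ on ℤ[σ]². The Plücker relation and the vanishing of 3 × 3 minors of a rank-2 product make m a tame
-- SL₂-tiling.
-- SL₂(ℤ[σ]) preserves ∧, and moving a path to another one with the same vertices rescales each x i by a
-- unit α i with α i α (i + 1) = 1; the units of ℤ[σ] are the powers of σ, so α i = σ^((-1)^i k).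
-- Conversely, if two pairs of sequences have the same pairings, the element of SL₂ sending the basis
-- x 0, x 1 to x′ 0, x′ 1 sends every x i to x′ i and every w j to w′ j, because ∧ against a unimodular
-- basis separates vectors.  Finally, a tame SL₂-tiling is determined by two adjacent rows and columns
-- (every 3 × 3 determinant is affine in a corner entry with slope a 2 × 2 minor, which is 1), so m agrees
-- with the tiling of x i = (m i 1 , - m i 0) and w j = m 0 j · x 1 - m 1 j · x 0.

open import Defs
open import Algebra.Bundles using (CommutativeRing)
open import Algebra.Consequences.Propositional using (comm∧idˡ⇒idʳ; comm∧distrˡ⇒distrʳ)
open import Algebra.Structures using (IsCommutativeRing)
open import Data.Empty using (⊥-elim)
open import Data.Integer as ℤ using (ℤ; +_; -[1+_]; ∣_∣)
import Data.Integer.Properties as ℤP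
import Data.Integer.Tactic.RingSolver as ℤ-Solver
open import Data.List using (_∷_; [])
open import Data.Nat as ℕ using (ℕ; zero; suc; z≤n; s≤s)
import Data.Nat.Properties as ℕP
open import Data.Product using (Σ; _×_; _,_; proj₁; proj₂)
open import Data.Sum using (_⊎_; [_,_]′; reduce) renaming (map to ⊎-map)
open import Function using (_∋_)
open import Level using (0ℓ)
open import Relation.Binary.PropositionalEquality
open import Relation.Binary.PropositionalEquality.Algebra using (isMagma)
open import Relation.Nullary using (¬_; Dec; yes; no)
open import Relation.Nullary.Decidable using (dec⇒maybe)
open import Tactic.RingSolver using (solve; solve-∀)
open import Tactic.RingSolver.Core.AlmostCommutativeRing using (AlmostCommutativeRing; fromCommutativeRing)

open ≡-Reasoning

_≟ᴱ_ : (x y : 𝔼) → Dec (x ≡ y)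
eis a b ≟ᴱ eis c d with a ℤ.≟ c | b ℤ.≟ d
... | yes refl | yes refl = yes refl
... | no a≢c   | _        = no λ e → a≢c (cong re e)
... | yes _    | no b≢d   = no λ e → b≢d (cong im e)

𝔼-isCommutativeRing : IsCommutativeRing _≡_ _+ᴱ_ _*ᴱ_ (λ x → -ᴱ x) 0ᴱ 1ᴱ
𝔼-isCommutativeRing = record
  { isRing = record
    { +-isAbelianGroup = record
      { isGroup = record
        { isMonoid = record
          { isSemigroup = record { isMagma = isMagma _+ᴱ_ ; assoc = +-assoc }
          ; identity = +-identityˡ , +-identityʳ }
        ; inverse = +-inverseˡ , +-inverseʳ
        ; ⁻¹-cong = cong (λ x → -ᴱ x) }
      ; comm = +-comm }
    ; *-cong = cong₂ _*ᴱ_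
    ; *-assoc = *-assoc
    ; *-identity = *-identityˡ , comm∧idˡ⇒idʳ *-comm *-identityˡ
    ; distrib = *-distribˡ-+ , comm∧distrˡ⇒distrʳ *-comm *-distribˡ-+ }
  ; *-comm = *-comm }
  where
  +-assoc : ∀ x y z → (x +ᴱ y) +ᴱ z ≡ x +ᴱ (y +ᴱ z)
  +-assoc (eis a b) (eis c d) (eis e f) = cong₂ eis (ℤP.+-assoc a c e) (ℤP.+-assoc b d f)
  +-comm : ∀ x y → x +ᴱ y ≡ y +ᴱ x
  +-comm (eis a b) (eis c d) = cong₂ eis (ℤP.+-comm a c) (ℤP.+-comm b d)
  +-identityˡ : ∀ x → 0ᴱ +ᴱ x ≡ x
  +-identityˡ (eis a b) = cong₂ eis (ℤP.+-identityˡ a) (ℤP.+-identityˡ b)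
  +-identityʳ : ∀ x → x +ᴱ 0ᴱ ≡ x
  +-identityʳ (eis a b) = cong₂ eis (ℤP.+-identityʳ a) (ℤP.+-identityʳ b)
  +-inverseˡ : ∀ x → (-ᴱ x) +ᴱ x ≡ 0ᴱ
  +-inverseˡ (eis a b) = cong₂ eis (ℤP.+-inverseˡ a) (ℤP.+-inverseˡ b)
  +-inverseʳ : ∀ x → x +ᴱ (-ᴱ x) ≡ 0ᴱ
  +-inverseʳ (eis a b) = cong₂ eis (ℤP.+-inverseʳ a) (ℤP.+-inverseʳ b)

  open import Data.Integer using (_+_; _-_; _*_)
  *-assoc : ∀ x y z → (x *ᴱ y) *ᴱ z ≡ x *ᴱ (y *ᴱ z)
  *-assoc (eis a b) (eis c d) (eis e f) = cong₂ eis (re-assoc a b c d e f) (im-assoc a b c d e f)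
    where
    re-assoc : ∀ a b c d e f → (a * c - b * d) * e - (a * d + b * c + b * d) * f
                              ≡ a * (c * e - d * f) - b * (c * f + d * e + d * f)
    re-assoc = ℤ-Solver.solve-∀
    im-assoc : ∀ a b c d e f → (a * c - b * d) * f + (a * d + b * c + b * d) * e + (a * d + b * c + b * d) * f
                              ≡ a * (c * f + d * e + d * f) + b * (c * e - d * f) + b * (c * f + d * e + d * f)
    im-assoc = ℤ-Solver.solve-∀
  *-comm : ∀ x y → x *ᴱ y ≡ y *ᴱ x
  *-comm (eis a b) (eis c d) = cong₂ eis (re-comm a b c d) (im-comm a b c d)
    where
    re-comm : ∀ a b c d → a * c - b * d ≡ c * a - d * b
    re-comm = ℤ-Solver.solve-∀
    im-comm : ∀ a b c d → a * d + b * c + b * d ≡ c * b + d * a + d * b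
    im-comm = ℤ-Solver.solve-∀
  *-identityˡ : ∀ x → 1ᴱ *ᴱ x ≡ x
  *-identityˡ (eis a b) = cong₂ eis (re-identity a b) (im-identity a b)
    where
    re-identity : ∀ a b → + 1 * a - + 0 * b ≡ a
    re-identity = ℤ-Solver.solve-∀
    im-identity : ∀ a b → + 1 * b + + 0 * a + + 0 * b ≡ b
    im-identity = ℤ-Solver.solve-∀
  *-distribˡ-+ : ∀ x y z → x *ᴱ (y +ᴱ z) ≡ x *ᴱ y +ᴱ x *ᴱ z
  *-distribˡ-+ (eis a b) (eis c d) (eis e f) = cong₂ eis (re-distrib a b c d e f) (im-distrib a b c d e f)
    where
    re-distrib : ∀ a b c d e f → a * (c + e) - b * (d + f) ≡ (a * c - b * d) + (a * e - b * f)
    re-distrib = ℤ-Solver.solve-∀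
    im-distrib : ∀ a b c d e f → a * (d + f) + b * (c + e) + b * (d + f)
                                ≡ (a * d + b * c + b * d) + (a * f + b * e + b * f)
    im-distrib = ℤ-Solver.solve-∀

𝔼-commutativeRing : CommutativeRing 0ℓ 0ℓ
𝔼-commutativeRing = record { isCommutativeRing = 𝔼-isCommutativeRing }

𝔼-ring : AlmostCommutativeRing 0ℓ 0ℓ
𝔼-ring = fromCommutativeRing 𝔼-commutativeRing λ x → dec⇒maybe (0ᴱ ≟ᴱ x)

open CommutativeRing 𝔼-commutativeRing
  using () renaming ( *-comm to *ᴱ-comm ; *-assoc to *ᴱ-assoc
                     ; *-identityˡ to *ᴱ-identityˡ ; *-identityʳ to *ᴱ-identityʳ )

x-y≡0⇒x≡y : ∀ {x y} → x -ᴱ y ≡ 0ᴱ → x ≡ y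
x-y≡0⇒x≡y {x} {y} x-y≡0 = begin
  x                ≡⟨ solve (x ∷ y ∷ []) 𝔼-ring ⟩
  (x -ᴱ y) +ᴱ y    ≡⟨ cong (_+ᴱ y) x-y≡0 ⟩
  0ᴱ +ᴱ y          ≡⟨ solve (y ∷ []) 𝔼-ring ⟩
  y                ∎

inverse-unique : ∀ x y z → x *ᴱ y ≡ 1ᴱ → x *ᴱ z ≡ 1ᴱ → y ≡ z
inverse-unique x y z xy≡1 xz≡1 = begin
  y                ≡⟨ sym (*ᴱ-identityʳ y) ⟩
  y *ᴱ 1ᴱ          ≡⟨ cong (y *ᴱ_) xz≡1 ⟨
  y *ᴱ (x *ᴱ z)    ≡⟨ solve (x ∷ y ∷ z ∷ []) 𝔼-ring ⟩
  (x *ᴱ y) *ᴱ z    ≡⟨ cong (_*ᴱ z) xy≡1 ⟩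
  1ᴱ *ᴱ z          ≡⟨ *ᴱ-identityˡ z ⟩
  z                ∎

normᴱ-*ᴱ : ∀ x y → normᴱ (x *ᴱ y) ≡ normᴱ x ℤ.* normᴱ y
normᴱ-*ᴱ (eis a b) (eis c d) = identity a b c d
  where
  open import Data.Integer using (_+_; _-_; _*_)
  identity : ∀ a b c d →
    (a * c - b * d) * (a * c - b * d) + (a * c - b * d) * (a * d + b * c + b * d)
      + (a * d + b * c + b * d) * (a * d + b * c + b * d)
    ≡ (a * a + a * b + b * b) * (c * c + c * d + d * d)
  identity = ℤ-Solver.solve-∀

normᴱ-swap : ∀ a b → normᴱ (eis a b) ≡ normᴱ (eis b a)
normᴱ-swap = identity
  where
  identity : ∀ a b → a ℤ.* a ℤ.+ a ℤ.* b ℤ.+ b ℤ.* b ≡ b ℤ.* b ℤ.+ b ℤ.* a ℤ.+ a ℤ.* a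
  identity = ℤ-Solver.solve-∀

square : ℕ → ℕ
square n = n ℕ.* n

-- Completing the square bounds both coordinates of an element by its norm.
four-normᴱ : ∀ a b → + 4 ℤ.* normᴱ (eis a b) ≡ + (square ∣ + 2 ℤ.* a ℤ.+ b ∣ ℕ.+ 3 ℕ.* square ∣ b ∣)
four-normᴱ a b = begin
  + 4 ℤ.* normᴱ (eis a b)                              ≡⟨ identity a b ⟩
  (+ 2 ℤ.* a ℤ.+ b) ℤ.* (+ 2 ℤ.* a ℤ.+ b) ℤ.+ + 3 ℤ.* (b ℤ.* b)
    ≡⟨ cong₂ (λ u v → u ℤ.+ + 3 ℤ.* v) (ℤ-square (+ 2 ℤ.* a ℤ.+ b)) (ℤ-square b) ⟩
  + (square ∣ + 2 ℤ.* a ℤ.+ b ∣) ℤ.+ + 3 ℤ.* + (square ∣ b ∣)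
    ≡⟨ cong (λ t → + (square ∣ + 2 ℤ.* a ℤ.+ b ∣) ℤ.+ t) (sym (ℤP.pos-* 3 (square ∣ b ∣))) ⟩
  + (square ∣ + 2 ℤ.* a ℤ.+ b ∣) ℤ.+ + (3 ℕ.* square ∣ b ∣)
    ≡⟨ sym (ℤP.pos-+ (square ∣ + 2 ℤ.* a ℤ.+ b ∣) (3 ℕ.* square ∣ b ∣)) ⟩
  + (square ∣ + 2 ℤ.* a ℤ.+ b ∣ ℕ.+ 3 ℕ.* square ∣ b ∣) ∎
  where
  identity : ∀ a b → + 4 ℤ.* (a ℤ.* a ℤ.+ a ℤ.* b ℤ.+ b ℤ.* b)
                     ≡ (+ 2 ℤ.* a ℤ.+ b) ℤ.* (+ 2 ℤ.* a ℤ.+ b) ℤ.+ + 3 ℤ.* (b ℤ.* b)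
  identity = ℤ-Solver.solve-∀
  ℤ-square : ∀ i → i ℤ.* i ≡ + (square ∣ i ∣)
  ℤ-square (+ n)    = sym (ℤP.pos-* n n)
  ℤ-square -[1+ n ] = refl

normᴱ≢-[1+n] : ∀ x n → normᴱ x ≢ -[1+ n ]
normᴱ≢-[1+n] (eis a b) n N≡ with trans (sym (four-normᴱ a b)) (cong (+ 4 ℤ.*_) N≡)
... | ()

3b²≤4N : ∀ a b n → normᴱ (eis a b) ≡ + n → 3 ℕ.* square ∣ b ∣ ℕ.≤ 4 ℕ.* n
3b²≤4N a b n N≡n = subst (3 ℕ.* square ∣ b ∣ ℕ.≤_) 4N≡ (ℕP.m≤n+m _ (square ∣ + 2 ℤ.* a ℤ.+ b ∣))
  where
  4N≡ : square ∣ + 2 ℤ.* a ℤ.+ b ∣ ℕ.+ 3 ℕ.* square ∣ b ∣ ≡ 4 ℕ.* n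
  4N≡ = ℤP.+-injective (trans (sym (four-normᴱ a b)) (trans (cong (+ 4 ℤ.*_) N≡n) (sym (ℤP.pos-* 4 n))))

normᴱ≡0⇒≡0ᴱ : ∀ x → normᴱ x ≡ + 0 → x ≡ 0ᴱ
normᴱ≡0⇒≡0ᴱ (eis a b) N≡0 =
  cong₂ eis (second≡0 b a (trans (sym (normᴱ-swap a b)) N≡0)) (second≡0 a b N≡0)
  where
  second≡0 : ∀ a b → normᴱ (eis a b) ≡ + 0 → b ≡ + 0
  second≡0 a b N≡0 = ℤP.∣i∣≡0⇒i≡0 (reduce (ℕP.m*n≡0⇒m≡0∨n≡0 _
    (ℕP.n≤0⇒n≡0 (ℕP.≤-trans (ℕP.m≤n*m _ 3) (3b²≤4N a b 0 N≡0)))))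

*ᴱ-integral : ∀ x y → x *ᴱ y ≡ 0ᴱ → x ≡ 0ᴱ ⊎ y ≡ 0ᴱ
*ᴱ-integral x y xy≡0 = ⊎-map (normᴱ≡0⇒≡0ᴱ x) (normᴱ≡0⇒≡0ᴱ y)
  (ℤP.i*j≡0⇒i≡0∨j≡0 (normᴱ x) (trans (sym (normᴱ-*ᴱ x y)) (cong normᴱ xy≡0)))

*ᴱ-cancelˡ : ∀ k x y → k ≢ 0ᴱ → k *ᴱ x ≡ k *ᴱ y → x ≡ y
*ᴱ-cancelˡ k x y k≢0 kx≡ky = [ (λ k≡0 → ⊥-elim (k≢0 k≡0)) , x-y≡0⇒x≡y ]′ (*ᴱ-integral k (x -ᴱ y) k[x-y]≡0)
  where
  k[x-y]≡0 : k *ᴱ (x -ᴱ y) ≡ 0ᴱ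
  k[x-y]≡0 = begin
    k *ᴱ (x -ᴱ y)          ≡⟨ solve (k ∷ x ∷ y ∷ []) 𝔼-ring ⟩
    k *ᴱ x -ᴱ k *ᴱ y       ≡⟨ cong (_-ᴱ k *ᴱ y) kx≡ky ⟩
    k *ᴱ y -ᴱ k *ᴱ y       ≡⟨ solve (k ∷ y ∷ []) 𝔼-ring ⟩
    0ᴱ                     ∎

*ᴱ≡1ᴱ⇒IsUnit : ∀ x y → x *ᴱ y ≡ 1ᴱ → IsUnit x
*ᴱ≡1ᴱ⇒IsUnit x y xy≡1 = nonneg-abs≡1 (normᴱ x) refl
  (ℕP.m*n≡1⇒m≡1 _ _ (trans (sym (ℤP.abs-* (normᴱ x) (normᴱ y)))
                          (cong ∣_∣ (trans (sym (normᴱ-*ᴱ x y)) (cong normᴱ xy≡1)))))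
  where
  nonneg-abs≡1 : ∀ z → normᴱ x ≡ z → ∣ z ∣ ≡ 1 → normᴱ x ≡ + 1
  nonneg-abs≡1 (+ .1)     N≡z refl = N≡z
  nonneg-abs≡1 -[1+ .0 ] N≡z refl = ⊥-elim (normᴱ≢-[1+n] x 0 N≡z)

IsUnit⇒σ-power : ∀ x → IsUnit x → Σ ℕ λ n → x ≡ σ^ℕ n
IsUnit⇒σ-power (eis a b) N≡1 =
  enumerate a b (≤1 (3b²≤4N b a 1 (trans (normᴱ-swap b a) N≡1))) (≤1 (3b²≤4N a b 1 N≡1)) N≡1
  where
  ≤1 : ∀ {n} → 3 ℕ.* square n ℕ.≤ 4 ℕ.* 1 → n ℕ.≤ 1
  ≤1 {0} _ = z≤n
  ≤1 {1} _ = s≤s z≤n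
  ≤1 {suc (suc n)} 3n²≤4 with ℕP.≤-trans (ℕP.*-monoʳ-≤ 3 (ℕP.*-mono-≤ 2≤n 2≤n)) 3n²≤4
    where 2≤n = s≤s (s≤s (z≤n {n}))
  ... | s≤s (s≤s (s≤s (s≤s ())))
  enumerate : ∀ a b → ∣ a ∣ ℕ.≤ 1 → ∣ b ∣ ℕ.≤ 1 → IsUnit (eis a b) → Σ ℕ λ n → eis a b ≡ σ^ℕ n
  enumerate (+ 1)     (+ 0)     _ _ _ = 0 , refl
  enumerate (+ 0)     (+ 1)     _ _ _ = 1 , refl
  enumerate -[1+ 0 ]  (+ 1)     _ _ _ = 2 , refl
  enumerate -[1+ 0 ]  (+ 0)     _ _ _ = 3 , refl
  enumerate (+ 0)     -[1+ 0 ]  _ _ _ = 4 , refl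
  enumerate (+ 1)     -[1+ 0 ]  _ _ _ = 5 , refl
  enumerate (+ 0)     (+ 0)     _ _ ()
  enumerate (+ 1)     (+ 1)     _ _ ()
  enumerate -[1+ 0 ]  -[1+ 0 ]  _ _ ()
  enumerate (+ suc (suc _)) _ (s≤s ()) _ _
  enumerate -[1+ suc _ ]    _ (s≤s ()) _ _
  enumerate _ (+ suc (suc _)) _ (s≤s ()) _
  enumerate _ -[1+ suc _ ]    _ (s≤s ()) _

next : ℤ → ℤ
next i = i ℤ.+ + 1

ℤ-induction : (P : ℤ → Set) → P (+ 0) → (∀ i → P i → P (next i)) → (∀ i → P (next i) → P i) →
              ∀ i → P i
ℤ-induction P P0 up down (+ zero)      = P0
ℤ-induction P P0 up down (+ suc n)     =
  subst P (cong +_ (ℕP.+-comm n 1)) (up (+ n) (ℤ-induction P P0 up down (+ n)))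
ℤ-induction P P0 up down -[1+ zero ]   = down -[1+ 0 ] P0
ℤ-induction P P0 up down -[1+ suc n ]  = down -[1+ suc n ] (ℤ-induction P P0 up down -[1+ n ])

ℤ-induction₂ : (P : ℤ → Set) → P (+ 0) → P (+ 1) →
               (∀ i → P i → P (next i) → P (next (next i))) →
               (∀ i → P (next i) → P (next (next i)) → P i) →
               ∀ i → P i
ℤ-induction₂ P P0 P1 up down i = proj₁ (ℤ-induction (λ i → P i × P (next i)) (P0 , P1)
  (λ i (Pi , Pi+1) → Pi+1 , up i Pi Pi+1) (λ i (Pi+1 , Pi+2) → down i Pi+1 Pi+2 , Pi+1) i)

sgn-next : ∀ i → sgn (next i) ≡ ℤ.- sgn i
sgn-next (+ n) rewrite ℕP.+-comm n 1 = refl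
sgn-next -[1+ zero ]  = refl
sgn-next -[1+ suc n ] = sym (ℤP.neg-involutive (alt (suc n)))

σ^-next : ∀ z → σ^ (next z) ≡ σ *ᴱ σ^ z
σ^-next (+ n) rewrite ℕP.+-comm n 1 = refl
σ^-next -[1+ zero ]  = refl
σ^-next -[1+ suc n ] = begin
  σ⁻¹^ℕ (suc n)                  ≡⟨ *ᴱ-identityˡ _ ⟨
  1ᴱ *ᴱ σ⁻¹^ℕ (suc n)            ≡⟨ *ᴱ-assoc σ σ⁻¹ (σ⁻¹^ℕ (suc n)) ⟩
  σ *ᴱ (σ⁻¹ *ᴱ σ⁻¹^ℕ (suc n))    ∎

σ^-+ : ∀ a b → σ^ (a ℤ.+ b) ≡ σ^ a *ᴱ σ^ b
σ^-+ a = ℤ-induction (λ b → σ^ (a ℤ.+ b) ≡ σ^ a *ᴱ σ^ b)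
  (trans (cong σ^ (ℤP.+-identityʳ a)) (sym (*ᴱ-identityʳ (σ^ a)))) up down
  where
  step : ∀ b → σ^ (a ℤ.+ next b) ≡ σ *ᴱ σ^ (a ℤ.+ b)
  step b = trans (cong σ^ (sym (ℤP.+-assoc a b (+ 1)))) (σ^-next (a ℤ.+ b))
  shift : ∀ b → σ^ a *ᴱ σ^ (next b) ≡ σ *ᴱ (σ^ a *ᴱ σ^ b)
  shift b = trans (cong (σ^ a *ᴱ_) (σ^-next b)) (swap (σ^ a) (σ^ b))
    where
    swap : ∀ x y → x *ᴱ (σ *ᴱ y) ≡ σ *ᴱ (x *ᴱ y)
    swap = solve-∀ 𝔼-ring
  up : ∀ b → σ^ (a ℤ.+ b) ≡ σ^ a *ᴱ σ^ b → σ^ (a ℤ.+ next b) ≡ σ^ a *ᴱ σ^ (next b)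
  up b IH = trans (step b) (trans (cong (σ *ᴱ_) IH) (sym (shift b)))
  down : ∀ b → σ^ (a ℤ.+ next b) ≡ σ^ a *ᴱ σ^ (next b) → σ^ (a ℤ.+ b) ≡ σ^ a *ᴱ σ^ b
  down b IH = *ᴱ-cancelˡ σ _ _ (λ ()) (trans (sym (step b)) (trans IH (shift b)))

σ^-inverse : ∀ z → σ^ (ℤ.- z) *ᴱ σ^ z ≡ 1ᴱ
σ^-inverse z = trans (sym (σ^-+ (ℤ.- z) z)) (cong σ^ (ℤP.+-inverseˡ z))

σ^-alternating : ∀ k i → σ^ (sgn i ℤ.* k) *ᴱ σ^ (sgn (next i) ℤ.* k) ≡ 1ᴱ
σ^-alternating k i = begin
  σ^ (sgn i ℤ.* k) *ᴱ σ^ (sgn (next i) ℤ.* k)   ≡⟨ cong (λ e → σ^ (sgn i ℤ.* k) *ᴱ σ^ e) next-exponent ⟨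
  σ^ (sgn i ℤ.* k) *ᴱ σ^ (ℤ.- (sgn i ℤ.* k))   ≡⟨ *ᴱ-comm (σ^ (sgn i ℤ.* k)) _ ⟩
  σ^ (ℤ.- (sgn i ℤ.* k)) *ᴱ σ^ (sgn i ℤ.* k)   ≡⟨ σ^-inverse (sgn i ℤ.* k) ⟩
  1ᴱ                                           ∎
  where
  next-exponent : ℤ.- (sgn i ℤ.* k) ≡ sgn (next i) ℤ.* k
  next-exponent = trans (ℤP.neg-distribˡ-* (sgn i) k) (cong (ℤ._* k) (sym (sgn-next i)))

alternating-units : ∀ (α : ℤ → 𝔼) → (∀ i → α i *ᴱ α (next i) ≡ 1ᴱ) →
                    Σ ℤ λ k → ∀ i → α i ≡ σ^ (sgn i ℤ.* k)
alternating-units α α-alternating = k , ℤ-induction (λ i → α i ≡ σᵏ i) α₀≡σᵏ₀ up down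
  where
  α₀-power = IsUnit⇒σ-power (α (+ 0)) (*ᴱ≡1ᴱ⇒IsUnit (α (+ 0)) (α (+ 1)) (α-alternating (+ 0)))
  k : ℤ
  k = + proj₁ α₀-power
  σᵏ : ℤ → 𝔼
  σᵏ i = σ^ (sgn i ℤ.* k)
  α₀≡σᵏ₀ : α (+ 0) ≡ σᵏ (+ 0)
  α₀≡σᵏ₀ = trans (proj₂ α₀-power) (cong σ^ (sym (ℤP.*-identityˡ k)))
  up : ∀ i → α i ≡ σᵏ i → α (next i) ≡ σᵏ (next i)
  up i αᵢ≡σᵏᵢ = inverse-unique (α i) (α (next i)) (σᵏ (next i)) (α-alternating i)
    (subst (λ t → t *ᴱ σᵏ (next i) ≡ 1ᴱ) (sym αᵢ≡σᵏᵢ) (σ^-alternating k i))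
  down : ∀ i → α (next i) ≡ σᵏ (next i) → α i ≡ σᵏ i
  down i αᵢ₊₁≡σᵏᵢ₊₁ = inverse-unique (α (next i)) (α i) (σᵏ i)
    (trans (*ᴱ-comm (α (next i)) (α i)) (α-alternating i))
    (subst (λ t → t *ᴱ σᵏ i ≡ 1ᴱ) (sym αᵢ₊₁≡σᵏᵢ₊₁) (trans (*ᴱ-comm (σᵏ (next i)) (σᵏ i)) (σ^-alternating k i)))

TilingEquiv-sym : ∀ m m′ → TilingEquiv m m′ → TilingEquiv m′ m
TilingEquiv-sym m m′ (k , l , m′≡σᵉm) = ℤ.- k , ℤ.- l , λ i j → begin
  m i j                                      ≡⟨ *ᴱ-identityˡ (m i j) ⟨
  1ᴱ *ᴱ m i j                                ≡⟨ cong (_*ᴱ m i j) (σ^-inverse (e i j)) ⟨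
  (σ^ (ℤ.- e i j) *ᴱ σ^ (e i j)) *ᴱ m i j    ≡⟨ *ᴱ-assoc (σ^ (ℤ.- e i j)) (σ^ (e i j)) (m i j) ⟩
  σ^ (ℤ.- e i j) *ᴱ (σ^ (e i j) *ᴱ m i j)    ≡⟨ cong (σ^ (ℤ.- e i j) *ᴱ_) (m′≡σᵉm i j) ⟨
  σ^ (ℤ.- e i j) *ᴱ m′ i j                   ≡⟨ cong (λ t → σ^ t *ᴱ m′ i j) (negated (sgn i) (sgn j) k l) ⟩
  σ^ (sgn i ℤ.* ℤ.- k ℤ.+ sgn j ℤ.* ℤ.- l) *ᴱ m′ i j ∎
  where
  e : ℤ → ℤ → ℤ
  e i j = sgn i ℤ.* k ℤ.+ sgn j ℤ.* l
  negated : ∀ s t k l → ℤ.- (s ℤ.* k ℤ.+ t ℤ.* l) ≡ s ℤ.* ℤ.- k ℤ.+ t ℤ.* ℤ.- l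
  negated = ℤ-Solver.solve-∀

pointwise⇒TilingEquiv : ∀ m m′ → (∀ i j → m′ i j ≡ m i j) → TilingEquiv m m′
pointwise⇒TilingEquiv m m′ m′≡m = + 0 , + 0 , λ i j → begin
  m′ i j                                         ≡⟨ m′≡m i j ⟩
  m i j                                          ≡⟨ *ᴱ-identityˡ (m i j) ⟨
  σ^ (+ 0) *ᴱ m i j                              ≡⟨ cong (λ t → σ^ t *ᴱ m i j) (zero-exponent (sgn i) (sgn j)) ⟨
  σ^ (sgn i ℤ.* + 0 ℤ.+ sgn j ℤ.* + 0) *ᴱ m i j  ∎
  where
  zero-exponent : ∀ s t → s ℤ.* + 0 ℤ.+ t ℤ.* + 0 ≡ + 0
  zero-exponent = ℤ-Solver.solve-∀

-- The determinant pairing on ℤ[σ]²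

V : Set
V = 𝔼 × 𝔼

infix 7 _∧_
infixr 8 _·_ _⊙_
infixl 6 _-ᵥ_
infix 4 _∥_

_∧_ : V → V → 𝔼
(p , q) ∧ (r , s) = p *ᴱ s -ᴱ q *ᴱ r

_·_ : 𝔼 → V → V
k · (p , q) = k *ᴱ p , k *ᴱ q

_⊙_ : SL₂ → V → V
g ⊙ (p , q) = a g *ᴱ p +ᴱ b g *ᴱ q , c g *ᴱ p +ᴱ d g *ᴱ q

_-ᵥ_ : V → V → V
(p , q) -ᵥ (r , s) = p -ᴱ r , q -ᴱ s

_∥_ : V → V → Set
(p , q) ∥ (r , s) = p *ᴱ s ≡ r *ᴱ q

Nonzero : V → Set
Nonzero (p , q) = ¬ (p ≡ 0ᴱ × q ≡ 0ᴱ)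

vec : Pt → V
vec x = num x , den x

·-identityˡ : ∀ x → 1ᴱ · x ≡ x
·-identityˡ (p , q) = cong₂ _,_ (*ᴱ-identityˡ p) (*ᴱ-identityˡ q)

∧-antisym : ∀ x y → x ∧ y ≡ -ᴱ (y ∧ x)
∧-antisym (p , q) (r , s) =
  p *ᴱ s -ᴱ q *ᴱ r ≡ -ᴱ (r *ᴱ q -ᴱ s *ᴱ p) ∋ solve (p ∷ q ∷ r ∷ s ∷ []) 𝔼-ring

∧-swap : ∀ p q r s → (p , q) ∧ (r , s) ≡ p *ᴱ s -ᴱ r *ᴱ q
∧-swap p q r s = p *ᴱ s -ᴱ q *ᴱ r ≡ p *ᴱ s -ᴱ r *ᴱ q ∋ solve (p ∷ q ∷ r ∷ s ∷ []) 𝔼-ring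

∧-·-· : ∀ k l x y → (k · x) ∧ (l · y) ≡ (k *ᴱ l) *ᴱ (x ∧ y)
∧-·-· k l (p , q) (r , s) =
  (k *ᴱ p) *ᴱ (l *ᴱ s) -ᴱ (k *ᴱ q) *ᴱ (l *ᴱ r) ≡ (k *ᴱ l) *ᴱ (p *ᴱ s -ᴱ q *ᴱ r)
    ∋ solve (k ∷ l ∷ p ∷ q ∷ r ∷ s ∷ []) 𝔼-ring

∧-zeroˡ : ∀ x y → proj₁ x ≡ 0ᴱ × proj₂ x ≡ 0ᴱ → x ∧ y ≡ 0ᴱ
∧-zeroˡ (.0ᴱ , .0ᴱ) (r , s) (refl , refl) = 0ᴱ *ᴱ s -ᴱ 0ᴱ *ᴱ r ≡ 0ᴱ ∋ solve (r ∷ s ∷ []) 𝔼-ring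

∧-combinations : ∀ a b c d y z → (a · y -ᵥ b · z) ∧ (c · y -ᵥ d · z) ≡ (a *ᴱ d -ᴱ c *ᴱ b) *ᴱ (z ∧ y)
∧-combinations a b c d (p , q) (r , s) =
  (a *ᴱ p -ᴱ b *ᴱ r) *ᴱ (c *ᴱ q -ᴱ d *ᴱ s) -ᴱ (a *ᴱ q -ᴱ b *ᴱ s) *ᴱ (c *ᴱ p -ᴱ d *ᴱ r)
    ≡ (a *ᴱ d -ᴱ c *ᴱ b) *ᴱ (r *ᴱ q -ᴱ s *ᴱ p)
    ∋ solve (a ∷ b ∷ c ∷ d ∷ p ∷ q ∷ r ∷ s ∷ []) 𝔼-ring

cramer : ∀ b₀ b₁ y → (b₀ ∧ b₁) · y ≡ (b₀ ∧ y) · b₁ -ᵥ (b₁ ∧ y) · b₀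
cramer (p , q) (r , s) (y₁ , y₂) = cong₂ _,_ (first p q r s y₁ y₂) (second p q r s y₁ y₂)
  where
  first : ∀ p q r s y₁ y₂ → (p *ᴱ s -ᴱ q *ᴱ r) *ᴱ y₁ ≡ (p *ᴱ y₂ -ᴱ q *ᴱ y₁) *ᴱ r -ᴱ (r *ᴱ y₂ -ᴱ s *ᴱ y₁) *ᴱ p
  first = solve-∀ 𝔼-ring
  second : ∀ p q r s y₁ y₂ → (p *ᴱ s -ᴱ q *ᴱ r) *ᴱ y₂ ≡ (p *ᴱ y₂ -ᴱ q *ᴱ y₁) *ᴱ s -ᴱ (r *ᴱ y₂ -ᴱ s *ᴱ y₁) *ᴱ q
  second = solve-∀ 𝔼-ring

∧-plücker : ∀ x y w z → (x ∧ w) *ᴱ (y ∧ z) -ᴱ (x ∧ z) *ᴱ (y ∧ w) ≡ (x ∧ y) *ᴱ (w ∧ z)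
∧-plücker (p , q) (p′ , q′) (r , s) (r′ , s′) = identity p q p′ q′ r s r′ s′
  where
  identity : ∀ p q p′ q′ r s r′ s′ →
    (p *ᴱ s -ᴱ q *ᴱ r) *ᴱ (p′ *ᴱ s′ -ᴱ q′ *ᴱ r′) -ᴱ (p *ᴱ s′ -ᴱ q *ᴱ r′) *ᴱ (p′ *ᴱ s -ᴱ q′ *ᴱ r)
      ≡ (p *ᴱ q′ -ᴱ q *ᴱ p′) *ᴱ (r *ᴱ s′ -ᴱ s *ᴱ r′)
  identity = solve-∀ 𝔼-ring

det3-∧≡0 : ∀ x₀ x₁ x₂ w₀ w₁ w₂ →
  det3 (x₀ ∧ w₀) (x₀ ∧ w₁) (x₀ ∧ w₂) (x₁ ∧ w₀) (x₁ ∧ w₁) (x₁ ∧ w₂) (x₂ ∧ w₀) (x₂ ∧ w₁) (x₂ ∧ w₂) ≡ 0ᴱ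
det3-∧≡0 (p₀ , q₀) (p₁ , q₁) (p₂ , q₂) (r₀ , s₀) (r₁ , s₁) (r₂ , s₂) =
  identity p₀ q₀ p₁ q₁ p₂ q₂ r₀ s₀ r₁ s₁ r₂ s₂
  where
  identity : ∀ p₀ q₀ p₁ q₁ p₂ q₂ r₀ s₀ r₁ s₁ r₂ s₂ →
      (p₀ *ᴱ s₀ -ᴱ q₀ *ᴱ r₀) *ᴱ ((p₁ *ᴱ s₁ -ᴱ q₁ *ᴱ r₁) *ᴱ (p₂ *ᴱ s₂ -ᴱ q₂ *ᴱ r₂) -ᴱ (p₁ *ᴱ s₂ -ᴱ q₁ *ᴱ r₂) *ᴱ (p₂ *ᴱ s₁ -ᴱ q₂ *ᴱ r₁))
    -ᴱ (p₀ *ᴱ s₁ -ᴱ q₀ *ᴱ r₁) *ᴱ ((p₁ *ᴱ s₀ -ᴱ q₁ *ᴱ r₀) *ᴱ (p₂ *ᴱ s₂ -ᴱ q₂ *ᴱ r₂) -ᴱ (p₁ *ᴱ s₂ -ᴱ q₁ *ᴱ r₂) *ᴱ (p₂ *ᴱ s₀ -ᴱ q₂ *ᴱ r₀))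
    +ᴱ (p₀ *ᴱ s₂ -ᴱ q₀ *ᴱ r₂) *ᴱ ((p₁ *ᴱ s₀ -ᴱ q₁ *ᴱ r₀) *ᴱ (p₂ *ᴱ s₁ -ᴱ q₂ *ᴱ r₁) -ᴱ (p₁ *ᴱ s₁ -ᴱ q₁ *ᴱ r₁) *ᴱ (p₂ *ᴱ s₀ -ᴱ q₂ *ᴱ r₀))
    ≡ 0ᴱ
  identity = solve-∀ 𝔼-ring

∥⇒∧≡0 : ∀ x y → x ∥ y → x ∧ y ≡ 0ᴱ
∥⇒∧≡0 (p , q) (r , s) ps≡rq = begin
  p *ᴱ s -ᴱ q *ᴱ r    ≡⟨ cong (_-ᴱ q *ᴱ r) ps≡rq ⟩
  r *ᴱ q -ᴱ q *ᴱ r    ≡⟨ solve (q ∷ r ∷ []) 𝔼-ring ⟩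
  0ᴱ                  ∎

∧≡0⇒∥ : ∀ x y → x ∧ y ≡ 0ᴱ → x ∥ y
∧≡0⇒∥ (p , q) (r , s) ps-qr≡0 = begin
  p *ᴱ s                        ≡⟨ solve (p ∷ q ∷ r ∷ s ∷ []) 𝔼-ring ⟩
  (p *ᴱ s -ᴱ q *ᴱ r) +ᴱ r *ᴱ q  ≡⟨ cong (_+ᴱ r *ᴱ q) ps-qr≡0 ⟩
  0ᴱ +ᴱ r *ᴱ q                  ≡⟨ solve (q ∷ r ∷ []) 𝔼-ring ⟩
  r *ᴱ q                        ∎

·-∥ : ∀ k x → (k · x) ∥ x
·-∥ k (p , q) = (k *ᴱ p) *ᴱ q ≡ p *ᴱ (k *ᴱ q) ∋ solve (k ∷ p ∷ q ∷ []) 𝔼-ring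

∥-trans : ∀ x y z → Nonzero y → x ∥ y → y ∥ z → x ∥ z
∥-trans (x₁ , x₂) (y₁ , y₂) (z₁ , z₂) y≢0 x∥y y∥z with y₁ ≟ᴱ 0ᴱ
... | no y₁≢0 = *ᴱ-cancelˡ y₁ _ _ y₁≢0 (begin
  y₁ *ᴱ (x₁ *ᴱ z₂)  ≡⟨ solve (x₁ ∷ y₁ ∷ z₂ ∷ []) 𝔼-ring ⟩
  x₁ *ᴱ (y₁ *ᴱ z₂)  ≡⟨ cong (x₁ *ᴱ_) y∥z ⟩
  x₁ *ᴱ (z₁ *ᴱ y₂)  ≡⟨ solve (x₁ ∷ z₁ ∷ y₂ ∷ []) 𝔼-ring ⟩
  z₁ *ᴱ (x₁ *ᴱ y₂)  ≡⟨ cong (z₁ *ᴱ_) x∥y ⟩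
  z₁ *ᴱ (y₁ *ᴱ x₂)  ≡⟨ solve (z₁ ∷ y₁ ∷ x₂ ∷ []) 𝔼-ring ⟩
  y₁ *ᴱ (z₁ *ᴱ x₂)  ∎)
... | yes y₁≡0 = *ᴱ-cancelˡ y₂ _ _ (λ y₂≡0 → y≢0 (y₁≡0 , y₂≡0)) (begin
  y₂ *ᴱ (x₁ *ᴱ z₂)  ≡⟨ solve (y₂ ∷ x₁ ∷ z₂ ∷ []) 𝔼-ring ⟩
  (x₁ *ᴱ y₂) *ᴱ z₂  ≡⟨ cong (_*ᴱ z₂) x∥y ⟩
  (y₁ *ᴱ x₂) *ᴱ z₂  ≡⟨ solve (y₁ ∷ x₂ ∷ z₂ ∷ []) 𝔼-ring ⟩
  x₂ *ᴱ (y₁ *ᴱ z₂)  ≡⟨ cong (x₂ *ᴱ_) y∥z ⟩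
  x₂ *ᴱ (z₁ *ᴱ y₂)  ≡⟨ solve (x₂ ∷ z₁ ∷ y₂ ∷ []) 𝔼-ring ⟩
  y₂ *ᴱ (z₁ *ᴱ x₂)  ∎)

∥⇒scalar-multiple : ∀ x x′ y → x ∧ x′ ≡ 1ᴱ → y ∥ x → y ≡ (y ∧ x′) · x
∥⇒scalar-multiple x x′ y x∧x′≡1 y∥x = begin
  y                                      ≡⟨ ·-identityˡ y ⟨
  1ᴱ · y                                 ≡⟨ cong (_· y) x∧x′≡1 ⟨
  (x ∧ x′) · y                           ≡⟨ cramer x x′ y ⟩
  (x ∧ y) · x′ -ᵥ (x′ ∧ y) · x           ≡⟨ cong (λ t → t · x′ -ᵥ (x′ ∧ y) · x) x∧y≡0 ⟩
  0ᴱ · x′ -ᵥ (x′ ∧ y) · x                ≡⟨ zero-combination x x′ y ⟩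
  (y ∧ x′) · x                           ∎
  where
  x∧y≡0 : x ∧ y ≡ 0ᴱ
  x∧y≡0 = ∥⇒∧≡0 x y (sym y∥x)
  zero-combination : ∀ x x′ y → 0ᴱ · x′ -ᵥ (x′ ∧ y) · x ≡ (y ∧ x′) · x
  zero-combination (p , q) (r , s) (y₁ , y₂) = cong₂ _,_ (component r s y₁ y₂ p) (component r s y₁ y₂ q)
    where
    component : ∀ r s y₁ y₂ t → 0ᴱ *ᴱ r -ᴱ (r *ᴱ y₂ -ᴱ s *ᴱ y₁) *ᴱ t ≡ (y₁ *ᴱ s -ᴱ y₂ *ᴱ r) *ᴱ t
    component = solve-∀ 𝔼-ring

∧-separates : ∀ b₀ b₁ x y → b₀ ∧ b₁ ≡ 1ᴱ → b₀ ∧ x ≡ b₀ ∧ y → b₁ ∧ x ≡ b₁ ∧ y → x ≡ y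
∧-separates b₀ b₁ x y b₀∧b₁≡1 b₀-eq b₁-eq = begin
  x                                      ≡⟨ ·-identityˡ x ⟨
  1ᴱ · x                                 ≡⟨ cong (_· x) b₀∧b₁≡1 ⟨
  (b₀ ∧ b₁) · x                          ≡⟨ cramer b₀ b₁ x ⟩
  (b₀ ∧ x) · b₁ -ᵥ (b₁ ∧ x) · b₀         ≡⟨ cong₂ (λ s t → s · b₁ -ᵥ t · b₀) b₀-eq b₁-eq ⟩
  (b₀ ∧ y) · b₁ -ᵥ (b₁ ∧ y) · b₀         ≡⟨ cramer b₀ b₁ y ⟨
  (b₀ ∧ b₁) · y                          ≡⟨ cong (_· y) b₀∧b₁≡1 ⟩
  1ᴱ · y                                 ≡⟨ ·-identityˡ y ⟩
  y                                      ∎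

∧-separatesʳ : ∀ b₀ b₁ x y → b₀ ∧ b₁ ≡ 1ᴱ → x ∧ b₀ ≡ y ∧ b₀ → x ∧ b₁ ≡ y ∧ b₁ → x ≡ y
∧-separatesʳ b₀ b₁ x y b₀∧b₁≡1 b₀-eq b₁-eq =
  ∧-separates b₀ b₁ x y b₀∧b₁≡1 (flip b₀ b₀-eq) (flip b₁ b₁-eq)
  where
  flip : ∀ b → x ∧ b ≡ y ∧ b → b ∧ x ≡ b ∧ y
  flip b eq = trans (∧-antisym b x) (trans (cong (λ t → -ᴱ t) eq) (sym (∧-antisym b y)))

∧≡1⇒nonzero : ∀ x y → x ∧ y ≡ 1ᴱ → Nonzero x
∧≡1⇒nonzero x y x∧y≡1 x≡0 with trans (sym (∧-zeroˡ x y x≡0)) x∧y≡1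
... | ()

∧≡1⇒irreducible : ∀ p q y → (p , q) ∧ y ≡ 1ᴱ → Irreducible p q
∧≡1⇒irreducible p q (r , s) p,q∧y≡1 k (c₁ , p≡kc₁) (c₂ , q≡kc₂) =
  *ᴱ≡1ᴱ⇒IsUnit k (c₁ *ᴱ s -ᴱ c₂ *ᴱ r) (begin
    k *ᴱ (c₁ *ᴱ s -ᴱ c₂ *ᴱ r)       ≡⟨ solve (k ∷ c₁ ∷ c₂ ∷ r ∷ s ∷ []) 𝔼-ring ⟩
    (k *ᴱ c₁) *ᴱ s -ᴱ (k *ᴱ c₂) *ᴱ r  ≡⟨ cong₂ (λ p q → (p , q) ∧ (r , s)) p≡kc₁ q≡kc₂ ⟨
    (p , q) ∧ (r , s)              ≡⟨ p,q∧y≡1 ⟩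
    1ᴱ                             ∎)

⊙-∧ : ∀ g x y → (g ⊙ x) ∧ (g ⊙ y) ≡ x ∧ y
⊙-∧ g@record { a = α ; b = β ; c = γ ; d = δ } (p , q) (r , s) = begin
  (α *ᴱ p +ᴱ β *ᴱ q) *ᴱ (γ *ᴱ r +ᴱ δ *ᴱ s) -ᴱ (γ *ᴱ p +ᴱ δ *ᴱ q) *ᴱ (α *ᴱ r +ᴱ β *ᴱ s)
    ≡⟨ solve (α ∷ β ∷ γ ∷ δ ∷ p ∷ q ∷ r ∷ s ∷ []) 𝔼-ring ⟩
  (α *ᴱ δ -ᴱ β *ᴱ γ) *ᴱ (p *ᴱ s -ᴱ q *ᴱ r)
    ≡⟨ cong (_*ᴱ (p *ᴱ s -ᴱ q *ᴱ r)) (det1 g) ⟩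
  1ᴱ *ᴱ (p *ᴱ s -ᴱ q *ᴱ r)
    ≡⟨ *ᴱ-identityˡ (p *ᴱ s -ᴱ q *ᴱ r) ⟩
  p *ᴱ s -ᴱ q *ᴱ r ∎

⊙-· : ∀ g k x → g ⊙ (k · x) ≡ k · (g ⊙ x)
⊙-· record { a = α ; b = β ; c = γ ; d = δ } k (p , q) = cong₂ _,_ (row α β) (row γ δ)
  where
  row : ∀ u v → u *ᴱ (k *ᴱ p) +ᴱ v *ᴱ (k *ᴱ q) ≡ k *ᴱ (u *ᴱ p +ᴱ v *ᴱ q)
  row u v = solve (u ∷ v ∷ k ∷ p ∷ q ∷ []) 𝔼-ring

∥-⊙ : ∀ g x y → x ∥ y → (g ⊙ x) ∥ (g ⊙ y)
∥-⊙ g x y x∥y = ∧≡0⇒∥ (g ⊙ x) (g ⊙ y) (trans (⊙-∧ g x y) (∥⇒∧≡0 x y x∥y))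

⊙-nonzero : ∀ g x → Nonzero x → Nonzero (g ⊙ x)
⊙-nonzero g (p , q) x≢0 gx≡0 = x≢0 (p≡0 , q≡0)
  where
  ∧-vanishes : ∀ y → (p , q) ∧ y ≡ 0ᴱ
  ∧-vanishes y = trans (sym (⊙-∧ g (p , q) y)) (∧-zeroˡ (g ⊙ (p , q)) (g ⊙ y) gx≡0)
  p≡0 : p ≡ 0ᴱ
  p≡0 = begin
    p                        ≡⟨ solve (p ∷ q ∷ []) 𝔼-ring ⟩
    p *ᴱ 1ᴱ -ᴱ q *ᴱ 0ᴱ       ≡⟨ ∧-vanishes (0ᴱ , 1ᴱ) ⟩
    0ᴱ                       ∎
  q≡0 : q ≡ 0ᴱ
  q≡0 = begin
    q                        ≡⟨ solve (p ∷ q ∷ []) 𝔼-ring ⟩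
    -ᴱ (p *ᴱ 0ᴱ -ᴱ q *ᴱ 1ᴱ)  ≡⟨ cong (λ t → -ᴱ t) (∧-vanishes (1ᴱ , 0ᴱ)) ⟩
    -ᴱ 0ᴱ                    ≡⟨⟩
    0ᴱ                       ∎

-- The element sending the unimodular basis b₀, b₁ to c₀, c₁: y ↦ (b₀ ∧ y) · c₁ -ᵥ (b₁ ∧ y) · c₀.
basis-change : ∀ b₀ b₁ c₀ c₁ → b₀ ∧ b₁ ≡ 1ᴱ → c₀ ∧ c₁ ≡ 1ᴱ →
               Σ SL₂ λ g → g ⊙ b₀ ≡ c₀ × g ⊙ b₁ ≡ c₁
basis-change b₀@(p₀ , q₀) b₁@(p₁ , q₁) c₀@(r₀ , s₀) c₁@(r₁ , s₁) b₀∧b₁≡1 c₀∧c₁≡1 = g , g⊙b₀ , g⊙b₁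
  where
  α β γ δ : 𝔼
  α = q₁ *ᴱ r₀ -ᴱ q₀ *ᴱ r₁
  β = p₀ *ᴱ r₁ -ᴱ p₁ *ᴱ r₀
  γ = q₁ *ᴱ s₀ -ᴱ q₀ *ᴱ s₁
  δ = p₀ *ᴱ s₁ -ᴱ p₁ *ᴱ s₀
  g : SL₂
  g = record { a = α ; b = β ; c = γ ; d = δ ; det1 = begin
    (q₁ *ᴱ r₀ -ᴱ q₀ *ᴱ r₁) *ᴱ (p₀ *ᴱ s₁ -ᴱ p₁ *ᴱ s₀) -ᴱ (p₀ *ᴱ r₁ -ᴱ p₁ *ᴱ r₀) *ᴱ (q₁ *ᴱ s₀ -ᴱ q₀ *ᴱ s₁)
                              ≡⟨ solve (p₀ ∷ q₀ ∷ p₁ ∷ q₁ ∷ r₀ ∷ s₀ ∷ r₁ ∷ s₁ ∷ []) 𝔼-ring ⟩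
    (p₀ *ᴱ q₁ -ᴱ q₀ *ᴱ p₁) *ᴱ (r₀ *ᴱ s₁ -ᴱ s₀ *ᴱ r₁)
                              ≡⟨ cong₂ _*ᴱ_ b₀∧b₁≡1 c₀∧c₁≡1 ⟩
    1ᴱ *ᴱ 1ᴱ                  ≡⟨ *ᴱ-identityˡ 1ᴱ ⟩
    1ᴱ                        ∎ }
  image₀ : ∀ p₀ q₀ p₁ q₁ u₀ u₁ →
    (q₁ *ᴱ u₀ -ᴱ q₀ *ᴱ u₁) *ᴱ p₀ +ᴱ (p₀ *ᴱ u₁ -ᴱ p₁ *ᴱ u₀) *ᴱ q₀ ≡ (p₀ *ᴱ q₁ -ᴱ q₀ *ᴱ p₁) *ᴱ u₀
  image₀ = solve-∀ 𝔼-ring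
  image₁ : ∀ p₀ q₀ p₁ q₁ u₀ u₁ →
    (q₁ *ᴱ u₀ -ᴱ q₀ *ᴱ u₁) *ᴱ p₁ +ᴱ (p₀ *ᴱ u₁ -ᴱ p₁ *ᴱ u₀) *ᴱ q₁ ≡ (p₀ *ᴱ q₁ -ᴱ q₀ *ᴱ p₁) *ᴱ u₁
  image₁ = solve-∀ 𝔼-ring
  g⊙b₀ : g ⊙ b₀ ≡ c₀
  g⊙b₀ = begin
    g ⊙ b₀           ≡⟨ cong₂ _,_ (image₀ p₀ q₀ p₁ q₁ r₀ r₁) (image₀ p₀ q₀ p₁ q₁ s₀ s₁) ⟩
    (b₀ ∧ b₁) · c₀   ≡⟨ cong (_· c₀) b₀∧b₁≡1 ⟩
    1ᴱ · c₀          ≡⟨ ·-identityˡ c₀ ⟩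
    c₀               ∎
  g⊙b₁ : g ⊙ b₁ ≡ c₁
  g⊙b₁ = begin
    g ⊙ b₁           ≡⟨ cong₂ _,_ (image₁ p₀ q₀ p₁ q₁ r₀ r₁) (image₁ p₀ q₀ p₁ q₁ s₀ s₁) ⟩
    (b₀ ∧ b₁) · c₁   ≡⟨ cong (_· c₁) b₀∧b₁≡1 ⟩
    1ᴱ · c₁          ≡⟨ ·-identityˡ c₁ ⟩
    c₁               ∎

same-∧⇒SL₂-related : ∀ (x w x′ w′ : ℤ → V) →
  x (+ 0) ∧ x (+ 1) ≡ 1ᴱ → x′ (+ 0) ∧ x′ (+ 1) ≡ 1ᴱ → w′ (+ 0) ∧ w′ (+ 1) ≡ 1ᴱ →
  (∀ i j → x i ∧ w j ≡ x′ i ∧ w′ j) →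
  Σ SL₂ λ g → (∀ i → g ⊙ x i ≡ x′ i) × (∀ j → g ⊙ w j ≡ w′ j)
same-∧⇒SL₂-related x w x′ w′ x-basis x′-basis w′-basis same-∧ = g , g⊙x , g⊙w
  where
  change = basis-change (x (+ 0)) (x (+ 1)) (x′ (+ 0)) (x′ (+ 1)) x-basis x′-basis
  g : SL₂
  g = proj₁ change
  ∧-images : ∀ i j → (g ⊙ x i) ∧ (g ⊙ w j) ≡ x′ i ∧ w′ j
  ∧-images i j = trans (⊙-∧ g (x i) (w j)) (same-∧ i j)
  ∧-with-x′ : ∀ i j → g ⊙ x i ≡ x′ i → x′ i ∧ (g ⊙ w j) ≡ x′ i ∧ w′ j
  ∧-with-x′ i j g⊙xᵢ≡x′ᵢ = trans (cong (_∧ (g ⊙ w j)) (sym g⊙xᵢ≡x′ᵢ)) (∧-images i j)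
  g⊙w : ∀ j → g ⊙ w j ≡ w′ j
  g⊙w j = ∧-separates (x′ (+ 0)) (x′ (+ 1)) (g ⊙ w j) (w′ j) x′-basis
    (∧-with-x′ (+ 0) j (proj₁ (proj₂ change))) (∧-with-x′ (+ 1) j (proj₂ (proj₂ change)))
  ∧-with-w′ : ∀ i j → (g ⊙ x i) ∧ w′ j ≡ x′ i ∧ w′ j
  ∧-with-w′ i j = trans (cong ((g ⊙ x i) ∧_) (sym (g⊙w j))) (∧-images i j)
  g⊙x : ∀ i → g ⊙ x i ≡ x′ i
  g⊙x i = ∧-separatesʳ (w′ (+ 0)) (w′ (+ 1)) (g ⊙ x i) (x′ i) w′-basis (∧-with-w′ i (+ 0)) (∧-with-w′ i (+ 1))

Unimodular : (ℤ → V) → Set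
Unimodular x = ∀ i → x i ∧ x (next i) ≡ 1ᴱ

rescaled-unimodular : ∀ (x : ℤ → V) (k : ℤ → 𝔼) → Unimodular x → (∀ i → k i *ᴱ k (next i) ≡ 1ᴱ) →
                      Unimodular (λ i → k i · x i)
rescaled-unimodular x k x-unimodular k-alternating i = begin
  (k i · x i) ∧ (k (next i) · x (next i))        ≡⟨ ∧-·-· (k i) (k (next i)) (x i) (x (next i)) ⟩
  (k i *ᴱ k (next i)) *ᴱ (x i ∧ x (next i))      ≡⟨ cong₂ _*ᴱ_ (k-alternating i) (x-unimodular i) ⟩
  1ᴱ *ᴱ 1ᴱ                                       ≡⟨ *ᴱ-identityˡ 1ᴱ ⟩
  1ᴱ                                             ∎

⊙-unimodular-scaling : ∀ g x x′ → Unimodular x → Unimodular x′ → (∀ i → (g ⊙ x i) ∥ x′ i) →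
                       Σ ℤ λ k → ∀ i → g ⊙ x i ≡ σ^ (sgn i ℤ.* k) · x′ i
⊙-unimodular-scaling g x x′ x-unimodular x′-unimodular gx∥x′ =
  k , λ i → trans (gx≡αx′ i) (cong (_· x′ i) (αᵢ≡σ^ i))
  where
  α : ℤ → 𝔼
  α i = (g ⊙ x i) ∧ x′ (next i)
  gx≡αx′ : ∀ i → g ⊙ x i ≡ α i · x′ i
  gx≡αx′ i = ∥⇒scalar-multiple (x′ i) (x′ (next i)) (g ⊙ x i) (x′-unimodular i) (gx∥x′ i)
  α-alternating : ∀ i → α i *ᴱ α (next i) ≡ 1ᴱ
  α-alternating i = begin
    α i *ᴱ α (next i)                                  ≡⟨ *ᴱ-identityʳ (α i *ᴱ α (next i)) ⟨
    (α i *ᴱ α (next i)) *ᴱ 1ᴱ                          ≡⟨ cong ((α i *ᴱ α (next i)) *ᴱ_) (x′-unimodular i) ⟨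
    (α i *ᴱ α (next i)) *ᴱ (x′ i ∧ x′ (next i))        ≡⟨ ∧-·-· (α i) (α (next i)) (x′ i) (x′ (next i)) ⟨
    (α i · x′ i) ∧ (α (next i) · x′ (next i))          ≡⟨ cong₂ _∧_ (gx≡αx′ i) (gx≡αx′ (next i)) ⟨
    (g ⊙ x i) ∧ (g ⊙ x (next i))                       ≡⟨ ⊙-∧ g (x i) (x (next i)) ⟩
    x i ∧ x (next i)                                   ≡⟨ x-unimodular i ⟩
    1ᴱ                                                 ∎
  k : ℤ
  k = proj₁ (alternating-units α α-alternating)
  αᵢ≡σ^ : ∀ i → α i ≡ σ^ (sgn i ℤ.* k)
  αᵢ≡σ^ = proj₂ (alternating-units α α-alternating)

∧-tiling : (ℤ → V) → (ℤ → V) → Mat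
∧-tiling x w i j = x i ∧ w j

∧-tiling-tame : ∀ x w → Unimodular x → Unimodular w → TameTiling (∧-tiling x w)
∧-tiling-tame x w x-unimodular w-unimodular = SL₂-tiling , tame
  where
  SL₂-tiling : IsSL₂Tiling (∧-tiling x w)
  SL₂-tiling i j = begin
    (x i ∧ w j) *ᴱ (x (next i) ∧ w (next j)) -ᴱ (x i ∧ w (next j)) *ᴱ (x (next i) ∧ w j)
      ≡⟨ ∧-plücker (x i) (x (next i)) (w j) (w (next j)) ⟩
    (x i ∧ x (next i)) *ᴱ (w j ∧ w (next j))
      ≡⟨ cong₂ _*ᴱ_ (x-unimodular i) (w-unimodular j) ⟩
    1ᴱ *ᴱ 1ᴱ
      ≡⟨ *ᴱ-identityˡ 1ᴱ ⟩
    1ᴱ ∎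
  tame : IsTame (∧-tiling x w)
  tame i j = det3-∧≡0 (x i) (x (i ℤ.+ + 1)) (x (i ℤ.+ + 2)) (w j) (w (j ℤ.+ + 1)) (w (j ℤ.+ + 2))

vectors : ∀ {γ} → Normalisation γ → ℤ → V
vectors ν i = nm ν i , dn ν i

vectors-unimodular : ∀ {γ} (ν : Normalisation γ) → Unimodular (vectors ν)
vectors-unimodular ν i = trans (∧-swap (nm ν i) (dn ν i) (nm ν (next i)) (dn ν (next i))) (unimod ν i)

vectors-nonzero : ∀ {γ} (ν : Normalisation γ) i → Nonzero (vectors ν i)
vectors-nonzero ν i = ∧≡1⇒nonzero (vectors ν i) (vectors ν (next i)) (vectors-unimodular ν i)

unimodular-swapped : ∀ x → Unimodular x → ∀ i →
  proj₁ (x i) *ᴱ proj₂ (x (next i)) -ᴱ proj₁ (x (next i)) *ᴱ proj₂ (x i) ≡ 1ᴱ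
unimodular-swapped x x-unimodular i =
  trans (sym (∧-swap (proj₁ (x i)) (proj₂ (x i)) (proj₁ (x (next i))) (proj₂ (x (next i))))) (x-unimodular i)

path-through : (x : ℤ → V) → Unimodular x → Path
path-through x x-unimodular = record { vtx = vertex ; adj = adjacent }
  where
  vertex : ℤ → Pt
  vertex i = pt (proj₁ (x i)) (proj₂ (x i)) (∧≡1⇒nonzero (x i) (x (next i)) (x-unimodular i))
  irreducible : ∀ i → IrrRep (proj₁ (x i)) (proj₂ (x i)) (vertex i)
  irreducible i = ∧≡1⇒irreducible _ _ (x (next i)) (x-unimodular i) , refl
  adjacent : ∀ i → Adj (vertex i) (vertex (next i))
  adjacent i = _ , _ , _ , _ , irreducible i , irreducible (next i) ,
               cong normᴱ (unimodular-swapped x x-unimodular i)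

path-normalisation : (x : ℤ → V) (x-unimodular : Unimodular x) → Normalisation (path-through x x-unimodular)
path-normalisation x x-unimodular = record
  { nm = λ i → proj₁ (x i)
  ; dn = λ i → proj₂ (x i)
  ; irrep = λ i → ∧≡1⇒irreducible _ _ (x (next i)) (x-unimodular i) , refl
  ; unimod = unimodular-swapped x x-unimodular }

Maps⇒∥ : ∀ g U U′ x x′ → Maps g U U′ → x ∥ vec U → x′ ∥ vec U′ → (g ⊙ x) ∥ x′
Maps⇒∥ g U U′ x x′ gU∥U′ x∥U x′∥U′ =
  ∥-trans (g ⊙ x) (g ⊙ vec U) x′ (⊙-nonzero g (vec U) (nonzero U)) (∥-⊙ g x (vec U) x∥U)
    (∥-trans (g ⊙ vec U) (vec U′) x′ (nonzero U′) gU∥U′ (sym x′∥U′))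

∥⇒Maps : ∀ g U U′ x x′ → Nonzero x → Nonzero x′ → (g ⊙ x) ∥ x′ → x ∥ vec U → x′ ∥ vec U′ → Maps g U U′
∥⇒Maps g U U′ x x′ x≢0 x′≢0 gx∥x′ x∥U x′∥U′ =
  ∥-trans (g ⊙ vec U) (g ⊙ x) (vec U′) (⊙-nonzero g x x≢0) (∥-⊙ g (vec U) x (sym x∥U))
    (∥-trans (g ⊙ x) x′ (vec U′) x′≢0 gx∥x′ x′∥U′)

Maps⇒σ-scaling : ∀ g {γ γ′} (ν : Normalisation γ) (ν′ : Normalisation γ′) →
  (∀ i → Maps g (vtx γ i) (vtx γ′ i)) → Σ ℤ λ k → ∀ i → g ⊙ vectors ν i ≡ σ^ (sgn i ℤ.* k) · vectors ν′ i
Maps⇒σ-scaling g {γ} {γ′} ν ν′ maps =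
  ⊙-unimodular-scaling g (vectors ν) (vectors ν′) (vectors-unimodular ν) (vectors-unimodular ν′) λ i →
    Maps⇒∥ g (vtx γ i) (vtx γ′ i) (vectors ν i) (vectors ν′ i) (maps i) (proj₂ (irrep ν i)) (proj₂ (irrep ν′ i))

⊙-rescaled⇒Maps : ∀ g {γ γ′} (ν : Normalisation γ) (ν′ : Normalisation γ′) (k : ℤ → 𝔼) →
  (∀ i → g ⊙ (k i · vectors ν i) ≡ vectors ν′ i) → ∀ i → Maps g (vtx γ i) (vtx γ′ i)
⊙-rescaled⇒Maps g {γ} {γ′} ν ν′ k gkx≡x′ i =
  ∥⇒Maps g (vtx γ i) (vtx γ′ i) x x′ (vectors-nonzero ν i) (vectors-nonzero ν′ i) gx∥x′
    (proj₂ (irrep ν i)) (proj₂ (irrep ν′ i))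
  where
  x x′ : V
  x = vectors ν i
  x′ = vectors ν′ i
  gx∥x′ : (g ⊙ x) ∥ x′
  gx∥x′ = subst ((g ⊙ x) ∥_) (trans (sym (⊙-· g (k i) x)) (gkx≡x′ i)) (sym (·-∥ (k i) (g ⊙ x)))

tilingOf-SL₂-invariant : ∀ {u v u′ v′} (nu : Normalisation u) (nv : Normalisation v)
  (nu′ : Normalisation u′) (nv′ : Normalisation v′) (g : SL₂) →
  (∀ i → Maps g (vtx u i) (vtx u′ i)) → (∀ j → Maps g (vtx v j) (vtx v′ j)) →
  TilingEquiv (tilingOf nu nv) (tilingOf nu′ nv′)
tilingOf-SL₂-invariant nu nv nu′ nv′ g maps-u maps-v =
  TilingEquiv-sym (tilingOf nu′ nv′) (tilingOf nu nv) (k , l , λ i j → begin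
    vectors nu i ∧ vectors nv j                                   ≡⟨ ⊙-∧ g (vectors nu i) (vectors nv j) ⟨
    (g ⊙ vectors nu i) ∧ (g ⊙ vectors nv j)                       ≡⟨ cong₂ _∧_ (gx≡ i) (gw≡ j) ⟩
    (σ^ (sgn i ℤ.* k) · vectors nu′ i) ∧ (σ^ (sgn j ℤ.* l) · vectors nv′ j)
      ≡⟨ ∧-·-· (σ^ (sgn i ℤ.* k)) (σ^ (sgn j ℤ.* l)) (vectors nu′ i) (vectors nv′ j) ⟩
    (σ^ (sgn i ℤ.* k) *ᴱ σ^ (sgn j ℤ.* l)) *ᴱ tilingOf nu′ nv′ i j
      ≡⟨ cong (_*ᴱ tilingOf nu′ nv′ i j) (σ^-+ (sgn i ℤ.* k) (sgn j ℤ.* l)) ⟨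
    σ^ (sgn i ℤ.* k ℤ.+ sgn j ℤ.* l) *ᴱ tilingOf nu′ nv′ i j      ∎)
  where
  k l : ℤ
  k = proj₁ (Maps⇒σ-scaling g nu nu′ maps-u)
  gx≡ = proj₂ (Maps⇒σ-scaling g nu nu′ maps-u)
  l = proj₁ (Maps⇒σ-scaling g nv nv′ maps-v)
  gw≡ = proj₂ (Maps⇒σ-scaling g nv nv′ maps-v)

tilingOf-injective : ∀ {u v u′ v′} (nu : Normalisation u) (nv : Normalisation v)
  (nu′ : Normalisation u′) (nv′ : Normalisation v′) →
  TilingEquiv (tilingOf nu nv) (tilingOf nu′ nv′) →
  Σ SL₂ λ g → (∀ i → Maps g (vtx u i) (vtx u′ i)) × (∀ j → Maps g (vtx v j) (vtx v′ j))
tilingOf-injective nu nv nu′ nv′ (k , l , m′≡σᵉm) =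
  g , ⊙-rescaled⇒Maps g nu nu′ σᵏ (proj₁ (proj₂ related)) , ⊙-rescaled⇒Maps g nv nv′ σˡ (proj₂ (proj₂ related))
  where
  σᵏ σˡ : ℤ → 𝔼
  σᵏ i = σ^ (sgn i ℤ.* k)
  σˡ j = σ^ (sgn j ℤ.* l)
  x̃ w̃ : ℤ → V
  x̃ i = σᵏ i · vectors nu i
  w̃ j = σˡ j · vectors nv j
  same-∧ : ∀ i j → x̃ i ∧ w̃ j ≡ vectors nu′ i ∧ vectors nv′ j
  same-∧ i j = begin
    x̃ i ∧ w̃ j                                    ≡⟨ ∧-·-· (σᵏ i) (σˡ j) (vectors nu i) (vectors nv j) ⟩
    (σᵏ i *ᴱ σˡ j) *ᴱ tilingOf nu nv i j          ≡⟨ cong (_*ᴱ tilingOf nu nv i j) (σ^-+ (sgn i ℤ.* k) (sgn j ℤ.* l)) ⟨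
    σ^ (sgn i ℤ.* k ℤ.+ sgn j ℤ.* l) *ᴱ tilingOf nu nv i j  ≡⟨ m′≡σᵉm i j ⟨
    tilingOf nu′ nv′ i j                          ∎
  related = same-∧⇒SL₂-related x̃ w̃ (vectors nu′) (vectors nv′)
    (rescaled-unimodular (vectors nu) σᵏ (vectors-unimodular nu) (σ^-alternating k) (+ 0))
    (vectors-unimodular nu′ (+ 0)) (vectors-unimodular nv′ (+ 0)) same-∧
  g : SL₂
  g = proj₁ related

-- Tame tilings are determined by two rows and two columns

affine-root-unique : ∀ {Δy Δz u y z} → Δy -ᴱ Δz ≡ u *ᴱ (y -ᴱ z) → u ≡ 1ᴱ → Δy ≡ 0ᴱ → Δz ≡ 0ᴱ → y ≡ z
affine-root-unique {y = y} {z} Δy-Δz≡ refl refl refl = x-y≡0⇒x≡y (begin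
  y -ᴱ z           ≡⟨ *ᴱ-identityˡ (y -ᴱ z) ⟨
  1ᴱ *ᴱ (y -ᴱ z)   ≡⟨ Δy-Δz≡ ⟨
  0ᴱ -ᴱ 0ᴱ         ≡⟨⟩
  0ᴱ               ∎)

det3-corner₂₂ : ∀ {x₀₀ x₀₁ x₀₂ x₁₀ x₁₁ x₁₂ x₂₀ x₂₁ x₂₂} {y₀₀ y₀₁ y₀₂ y₁₀ y₁₁ y₁₂ y₂₀ y₂₁ y₂₂} →
  x₀₀ ≡ y₀₀ → x₀₁ ≡ y₀₁ → x₀₂ ≡ y₀₂ → x₁₀ ≡ y₁₀ → x₁₁ ≡ y₁₁ → x₁₂ ≡ y₁₂ → x₂₀ ≡ y₂₀ → x₂₁ ≡ y₂₁ →
  x₀₀ *ᴱ x₁₁ -ᴱ x₀₁ *ᴱ x₁₀ ≡ 1ᴱ →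
  det3 x₀₀ x₀₁ x₀₂ x₁₀ x₁₁ x₁₂ x₂₀ x₂₁ x₂₂ ≡ 0ᴱ → det3 y₀₀ y₀₁ y₀₂ y₁₀ y₁₁ y₁₂ y₂₀ y₂₁ y₂₂ ≡ 0ᴱ → x₂₂ ≡ y₂₂
det3-corner₂₂ {x₀₀} {x₀₁} {x₀₂} {x₁₀} {x₁₁} {x₁₂} {x₂₀} {x₂₁} {x₂₂} {y₂₂ = y₂₂}
  refl refl refl refl refl refl refl refl =
  affine-root-unique (identity x₀₀ x₀₁ x₀₂ x₁₀ x₁₁ x₁₂ x₂₀ x₂₁ x₂₂ y₂₂)
  where
  identity : ∀ x₀₀ x₀₁ x₀₂ x₁₀ x₁₁ x₁₂ x₂₀ x₂₁ x₂₂ y₂₂ →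
    (x₀₀ *ᴱ (x₁₁ *ᴱ x₂₂ -ᴱ x₁₂ *ᴱ x₂₁) -ᴱ x₀₁ *ᴱ (x₁₀ *ᴱ x₂₂ -ᴱ x₁₂ *ᴱ x₂₀) +ᴱ x₀₂ *ᴱ (x₁₀ *ᴱ x₂₁ -ᴱ x₁₁ *ᴱ x₂₀))
      -ᴱ (x₀₀ *ᴱ (x₁₁ *ᴱ y₂₂ -ᴱ x₁₂ *ᴱ x₂₁) -ᴱ x₀₁ *ᴱ (x₁₀ *ᴱ y₂₂ -ᴱ x₁₂ *ᴱ x₂₀) +ᴱ x₀₂ *ᴱ (x₁₀ *ᴱ x₂₁ -ᴱ x₁₁ *ᴱ x₂₀))
    ≡ (x₀₀ *ᴱ x₁₁ -ᴱ x₀₁ *ᴱ x₁₀) *ᴱ (x₂₂ -ᴱ y₂₂)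
  identity = solve-∀ 𝔼-ring

det3-corner₂₀ : ∀ {x₀₀ x₀₁ x₀₂ x₁₀ x₁₁ x₁₂ x₂₀ x₂₁ x₂₂} {y₀₀ y₀₁ y₀₂ y₁₀ y₁₁ y₁₂ y₂₀ y₂₁ y₂₂} →
  x₀₀ ≡ y₀₀ → x₀₁ ≡ y₀₁ → x₀₂ ≡ y₀₂ → x₁₀ ≡ y₁₀ → x₁₁ ≡ y₁₁ → x₁₂ ≡ y₁₂ → x₂₁ ≡ y₂₁ → x₂₂ ≡ y₂₂ →
  x₀₁ *ᴱ x₁₂ -ᴱ x₀₂ *ᴱ x₁₁ ≡ 1ᴱ →
  det3 x₀₀ x₀₁ x₀₂ x₁₀ x₁₁ x₁₂ x₂₀ x₂₁ x₂₂ ≡ 0ᴱ → det3 y₀₀ y₀₁ y₀₂ y₁₀ y₁₁ y₁₂ y₂₀ y₂₁ y₂₂ ≡ 0ᴱ → x₂₀ ≡ y₂₀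
det3-corner₂₀ {x₀₀} {x₀₁} {x₀₂} {x₁₀} {x₁₁} {x₁₂} {x₂₀} {x₂₁} {x₂₂} {y₂₀ = y₂₀}
  refl refl refl refl refl refl refl refl =
  affine-root-unique (identity x₀₀ x₀₁ x₀₂ x₁₀ x₁₁ x₁₂ x₂₀ x₂₁ x₂₂ y₂₀)
  where
  identity : ∀ x₀₀ x₀₁ x₀₂ x₁₀ x₁₁ x₁₂ x₂₀ x₂₁ x₂₂ y₂₀ →
    (x₀₀ *ᴱ (x₁₁ *ᴱ x₂₂ -ᴱ x₁₂ *ᴱ x₂₁) -ᴱ x₀₁ *ᴱ (x₁₀ *ᴱ x₂₂ -ᴱ x₁₂ *ᴱ x₂₀) +ᴱ x₀₂ *ᴱ (x₁₀ *ᴱ x₂₁ -ᴱ x₁₁ *ᴱ x₂₀))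
      -ᴱ (x₀₀ *ᴱ (x₁₁ *ᴱ x₂₂ -ᴱ x₁₂ *ᴱ x₂₁) -ᴱ x₀₁ *ᴱ (x₁₀ *ᴱ x₂₂ -ᴱ x₁₂ *ᴱ y₂₀) +ᴱ x₀₂ *ᴱ (x₁₀ *ᴱ x₂₁ -ᴱ x₁₁ *ᴱ y₂₀))
    ≡ (x₀₁ *ᴱ x₁₂ -ᴱ x₀₂ *ᴱ x₁₁) *ᴱ (x₂₀ -ᴱ y₂₀)
  identity = solve-∀ 𝔼-ring

det3-corner₀₂ : ∀ {x₀₀ x₀₁ x₀₂ x₁₀ x₁₁ x₁₂ x₂₀ x₂₁ x₂₂} {y₀₀ y₀₁ y₀₂ y₁₀ y₁₁ y₁₂ y₂₀ y₂₁ y₂₂} →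
  x₀₀ ≡ y₀₀ → x₀₁ ≡ y₀₁ → x₁₀ ≡ y₁₀ → x₁₁ ≡ y₁₁ → x₁₂ ≡ y₁₂ → x₂₀ ≡ y₂₀ → x₂₁ ≡ y₂₁ → x₂₂ ≡ y₂₂ →
  x₁₀ *ᴱ x₂₁ -ᴱ x₁₁ *ᴱ x₂₀ ≡ 1ᴱ →
  det3 x₀₀ x₀₁ x₀₂ x₁₀ x₁₁ x₁₂ x₂₀ x₂₁ x₂₂ ≡ 0ᴱ → det3 y₀₀ y₀₁ y₀₂ y₁₀ y₁₁ y₁₂ y₂₀ y₂₁ y₂₂ ≡ 0ᴱ → x₀₂ ≡ y₀₂
det3-corner₀₂ {x₀₀} {x₀₁} {x₀₂} {x₁₀} {x₁₁} {x₁₂} {x₂₀} {x₂₁} {x₂₂} {y₀₂ = y₀₂}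
  refl refl refl refl refl refl refl refl =
  affine-root-unique (identity x₀₀ x₀₁ x₀₂ x₁₀ x₁₁ x₁₂ x₂₀ x₂₁ x₂₂ y₀₂)
  where
  identity : ∀ x₀₀ x₀₁ x₀₂ x₁₀ x₁₁ x₁₂ x₂₀ x₂₁ x₂₂ y₀₂ →
    (x₀₀ *ᴱ (x₁₁ *ᴱ x₂₂ -ᴱ x₁₂ *ᴱ x₂₁) -ᴱ x₀₁ *ᴱ (x₁₀ *ᴱ x₂₂ -ᴱ x₁₂ *ᴱ x₂₀) +ᴱ x₀₂ *ᴱ (x₁₀ *ᴱ x₂₁ -ᴱ x₁₁ *ᴱ x₂₀))
      -ᴱ (x₀₀ *ᴱ (x₁₁ *ᴱ x₂₂ -ᴱ x₁₂ *ᴱ x₂₁) -ᴱ x₀₁ *ᴱ (x₁₀ *ᴱ x₂₂ -ᴱ x₁₂ *ᴱ x₂₀) +ᴱ y₀₂ *ᴱ (x₁₀ *ᴱ x₂₁ -ᴱ x₁₁ *ᴱ x₂₀))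
    ≡ (x₁₀ *ᴱ x₂₁ -ᴱ x₁₁ *ᴱ x₂₀) *ᴱ (x₀₂ -ᴱ y₀₂)
  identity = solve-∀ 𝔼-ring

det3-corner₀₀ : ∀ {x₀₀ x₀₁ x₀₂ x₁₀ x₁₁ x₁₂ x₂₀ x₂₁ x₂₂} {y₀₀ y₀₁ y₀₂ y₁₀ y₁₁ y₁₂ y₂₀ y₂₁ y₂₂} →
  x₀₁ ≡ y₀₁ → x₀₂ ≡ y₀₂ → x₁₀ ≡ y₁₀ → x₁₁ ≡ y₁₁ → x₁₂ ≡ y₁₂ → x₂₀ ≡ y₂₀ → x₂₁ ≡ y₂₁ → x₂₂ ≡ y₂₂ →
  x₁₁ *ᴱ x₂₂ -ᴱ x₁₂ *ᴱ x₂₁ ≡ 1ᴱ →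
  det3 x₀₀ x₀₁ x₀₂ x₁₀ x₁₁ x₁₂ x₂₀ x₂₁ x₂₂ ≡ 0ᴱ → det3 y₀₀ y₀₁ y₀₂ y₁₀ y₁₁ y₁₂ y₂₀ y₂₁ y₂₂ ≡ 0ᴱ → x₀₀ ≡ y₀₀
det3-corner₀₀ {x₀₀} {x₀₁} {x₀₂} {x₁₀} {x₁₁} {x₁₂} {x₂₀} {x₂₁} {x₂₂} {y₀₀ = y₀₀}
  refl refl refl refl refl refl refl refl =
  affine-root-unique (identity x₀₀ x₀₁ x₀₂ x₁₀ x₁₁ x₁₂ x₂₀ x₂₁ x₂₂ y₀₀)
  where
  identity : ∀ x₀₀ x₀₁ x₀₂ x₁₀ x₁₁ x₁₂ x₂₀ x₂₁ x₂₂ y₀₀ →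
    (x₀₀ *ᴱ (x₁₁ *ᴱ x₂₂ -ᴱ x₁₂ *ᴱ x₂₁) -ᴱ x₀₁ *ᴱ (x₁₀ *ᴱ x₂₂ -ᴱ x₁₂ *ᴱ x₂₀) +ᴱ x₀₂ *ᴱ (x₁₀ *ᴱ x₂₁ -ᴱ x₁₁ *ᴱ x₂₀))
      -ᴱ (y₀₀ *ᴱ (x₁₁ *ᴱ x₂₂ -ᴱ x₁₂ *ᴱ x₂₁) -ᴱ x₀₁ *ᴱ (x₁₀ *ᴱ x₂₂ -ᴱ x₁₂ *ᴱ x₂₀) +ᴱ x₀₂ *ᴱ (x₁₀ *ᴱ x₂₁ -ᴱ x₁₁ *ᴱ x₂₀))
    ≡ (x₁₁ *ᴱ x₂₂ -ᴱ x₁₂ *ᴱ x₂₁) *ᴱ (x₀₀ -ᴱ y₀₀)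
  identity = solve-∀ 𝔼-ring

tame-block : ∀ M → IsTame M → ∀ i j →
  det3 (M i j)               (M i (next j))               (M i (next (next j)))
       (M (next i) j)        (M (next i) (next j))        (M (next i) (next (next j)))
       (M (next (next i)) j) (M (next (next i)) (next j)) (M (next (next i)) (next (next j))) ≡ 0ᴱ
tame-block M M-tame i j = subst₂ (λ i₂ j₂ →
  det3 (M i j)         (M i (next j))         (M i j₂)
       (M (next i) j)  (M (next i) (next j))  (M (next i) j₂)
       (M i₂ j)        (M i₂ (next j))        (M i₂ j₂) ≡ 0ᴱ) (+2≡next² i) (+2≡next² j) (M-tame i j)
  where
  +2≡next² : ∀ k → k ℤ.+ + 2 ≡ next (next k)
  +2≡next² k = sym (ℤP.+-assoc k (+ 1) (+ 1))

tame-tiling-unique : ∀ M T → TameTiling M → IsTame T →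
  (∀ j → M (+ 0) j ≡ T (+ 0) j) → (∀ j → M (+ 1) j ≡ T (+ 1) j) →
  (∀ i → M i (+ 0) ≡ T i (+ 0)) → (∀ i → M i (+ 1) ≡ T i (+ 1)) →
  ∀ i j → M i j ≡ T i j
tame-tiling-unique M T (M-SL₂ , M-tame) T-tame row₀ row₁ column₀ column₁ =
  ℤ-induction₂ (λ i → ∀ j → M i j ≡ T i j) row₀ row₁ rows-up rows-down
  where
  M-block = tame-block M M-tame
  T-block = tame-block T T-tame
  rows-up : ∀ i → (∀ j → M i j ≡ T i j) → (∀ j → M (next i) j ≡ T (next i) j) →
            ∀ j → M (next (next i)) j ≡ T (next (next i)) j
  rows-up i R₀ R₁ = ℤ-induction₂ (λ j → M (next (next i)) j ≡ T (next (next i)) j) (column₀ _) (column₁ _)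
    (λ j e₀ e₁ → det3-corner₂₂ (R₀ j) (R₀ (next j)) (R₀ (next (next j))) (R₁ j) (R₁ (next j)) (R₁ (next (next j)))
                               e₀ e₁ (M-SL₂ i j) (M-block i j) (T-block i j))
    (λ j e₁ e₂ → det3-corner₂₀ (R₀ j) (R₀ (next j)) (R₀ (next (next j))) (R₁ j) (R₁ (next j)) (R₁ (next (next j)))
                               e₁ e₂ (M-SL₂ i (next j)) (M-block i j) (T-block i j))
  rows-down : ∀ i → (∀ j → M (next i) j ≡ T (next i) j) → (∀ j → M (next (next i)) j ≡ T (next (next i)) j) →
              ∀ j → M i j ≡ T i j
  rows-down i R₁ R₂ = ℤ-induction₂ (λ j → M i j ≡ T i j) (column₀ _) (column₁ _)
    (λ j e₀ e₁ → det3-corner₀₂ e₀ e₁ (R₁ j) (R₁ (next j)) (R₁ (next (next j))) (R₂ j) (R₂ (next j)) (R₂ (next (next j)))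
                               (M-SL₂ (next i) j) (M-block i j) (T-block i j))
    (λ j e₁ e₂ → det3-corner₀₀ e₁ e₂ (R₁ j) (R₁ (next j)) (R₁ (next (next j))) (R₂ j) (R₂ (next j)) (R₂ (next (next j)))
                               (M-SL₂ (next i) (next j)) (M-block i j) (T-block i j))

-- x i = (m i 1 , - m i 0) and w j = m 0 j · x 1 - m 1 j · x 0 reproduce rows 0, 1 and columns 0, 1 of m.
tame-tiling-factorisation : ∀ m → TameTiling m →
  Σ (ℤ → V) λ x → Σ (ℤ → V) λ w → Unimodular x × Unimodular w × (∀ i j → x i ∧ w j ≡ m i j)
tame-tiling-factorisation m (m-SL₂ , m-tame) = x , w , x-unimodular , w-unimodular , ∧≡m
  where
  x w : ℤ → V
  x i = m i (+ 1) , -ᴱ m i (+ 0)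
  w j = m (+ 0) j · x (+ 1) -ᵥ m (+ 1) j · x (+ 0)
  x-unimodular : Unimodular x
  x-unimodular i = trans (minor (m i (+ 0)) (m i (+ 1)) (m (next i) (+ 0)) (m (next i) (+ 1))) (m-SL₂ i (+ 0))
    where
    minor : ∀ a b c d → b *ᴱ (-ᴱ c) -ᴱ (-ᴱ a) *ᴱ d ≡ a *ᴱ d -ᴱ b *ᴱ c
    minor = solve-∀ 𝔼-ring
  w-unimodular : Unimodular w
  w-unimodular j = begin
    w j ∧ w (next j)
      ≡⟨ ∧-combinations (m (+ 0) j) (m (+ 1) j) (m (+ 0) (next j)) (m (+ 1) (next j)) (x (+ 1)) (x (+ 0)) ⟩
    (m (+ 0) j *ᴱ m (+ 1) (next j) -ᴱ m (+ 0) (next j) *ᴱ m (+ 1) j) *ᴱ (x (+ 0) ∧ x (+ 1))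
      ≡⟨ cong₂ _*ᴱ_ (m-SL₂ (+ 0) j) (x-unimodular (+ 0)) ⟩
    1ᴱ *ᴱ 1ᴱ
      ≡⟨ *ᴱ-identityˡ 1ᴱ ⟩
    1ᴱ ∎
  m₀₀ m₀₁ m₁₀ m₁₁ : 𝔼
  m₀₀ = m (+ 0) (+ 0)
  m₀₁ = m (+ 0) (+ 1)
  m₁₀ = m (+ 1) (+ 0)
  m₁₁ = m (+ 1) (+ 1)
  drop-minor : ∀ {e} c → e ≡ c *ᴱ (m₀₀ *ᴱ m₁₁ -ᴱ m₀₁ *ᴱ m₁₀) → e ≡ c
  drop-minor c e≡ = trans e≡ (trans (cong (c *ᴱ_) (m-SL₂ (+ 0) (+ 0))) (*ᴱ-identityʳ c))
  row₀ : ∀ a₀ b₀ a₁ b₁ c d →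
    b₀ *ᴱ (c *ᴱ (-ᴱ a₁) -ᴱ d *ᴱ (-ᴱ a₀)) -ᴱ (-ᴱ a₀) *ᴱ (c *ᴱ b₁ -ᴱ d *ᴱ b₀) ≡ c *ᴱ (a₀ *ᴱ b₁ -ᴱ b₀ *ᴱ a₁)
  row₀ = solve-∀ 𝔼-ring
  row₁ : ∀ a₀ b₀ a₁ b₁ c d →
    b₁ *ᴱ (c *ᴱ (-ᴱ a₁) -ᴱ d *ᴱ (-ᴱ a₀)) -ᴱ (-ᴱ a₁) *ᴱ (c *ᴱ b₁ -ᴱ d *ᴱ b₀) ≡ d *ᴱ (a₀ *ᴱ b₁ -ᴱ b₀ *ᴱ a₁)
  row₁ = solve-∀ 𝔼-ring
  column₀ : ∀ a₀ b₀ a₁ b₁ a b →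
    b *ᴱ (a₀ *ᴱ (-ᴱ a₁) -ᴱ a₁ *ᴱ (-ᴱ a₀)) -ᴱ (-ᴱ a) *ᴱ (a₀ *ᴱ b₁ -ᴱ a₁ *ᴱ b₀) ≡ a *ᴱ (a₀ *ᴱ b₁ -ᴱ b₀ *ᴱ a₁)
  column₀ = solve-∀ 𝔼-ring
  column₁ : ∀ a₀ b₀ a₁ b₁ a b →
    b *ᴱ (b₀ *ᴱ (-ᴱ a₁) -ᴱ b₁ *ᴱ (-ᴱ a₀)) -ᴱ (-ᴱ a) *ᴱ (b₀ *ᴱ b₁ -ᴱ b₁ *ᴱ b₀) ≡ b *ᴱ (a₀ *ᴱ b₁ -ᴱ b₀ *ᴱ a₁)
  column₁ = solve-∀ 𝔼-ring
  ∧≡m : ∀ i j → x i ∧ w j ≡ m i j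
  ∧≡m = tame-tiling-unique (∧-tiling x w) m (∧-tiling-tame x w x-unimodular w-unimodular) m-tame
    (λ j → drop-minor (m (+ 0) j) (row₀ m₀₀ m₀₁ m₁₀ m₁₁ (m (+ 0) j) (m (+ 1) j)))
    (λ j → drop-minor (m (+ 1) j) (row₁ m₀₀ m₀₁ m₁₀ m₁₁ (m (+ 0) j) (m (+ 1) j)))
    (λ i → drop-minor (m i (+ 0)) (column₀ m₀₀ m₀₁ m₁₀ m₁₁ (m i (+ 0)) (m i (+ 1))))
    (λ i → drop-minor (m i (+ 1)) (column₁ m₀₀ m₀₁ m₁₀ m₁₁ (m i (+ 0)) (m i (+ 1))))

theorem5p20 :
  -- the image is a tame SL₂(ℤ[σ])-tiling
  ((u v : Path) (nu : Normalisation u) (nv : Normalisation v) →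
     TameTiling (tilingOf nu nv))
  -- well defined: independent of normalisations, invariant under simultaneous SL₂ action
  × ((u v u' v' : Path) (nu : Normalisation u) (nv : Normalisation v)
     (nu' : Normalisation u') (nv' : Normalisation v') (g : SL₂) →
     (∀ i → Maps g (vtx u i) (vtx u' i)) → (∀ j → Maps g (vtx v j) (vtx v' j)) →
     TilingEquiv (tilingOf nu nv) (tilingOf nu' nv'))
  -- injective on classes
  × ((u v u' v' : Path) (nu : Normalisation u) (nv : Normalisation v)
     (nu' : Normalisation u') (nv' : Normalisation v') →
     TilingEquiv (tilingOf nu nv) (tilingOf nu' nv') →
     Σ SL₂ (λ g → (∀ i → Maps g (vtx u i) (vtx u' i)) × (∀ j → Maps g (vtx v j) (vtx v' j))))
  -- surjective onto classes of tame tilings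
  × ((m : ℤ → ℤ → 𝔼) → TameTiling m →
     Σ Path (λ u → Σ Path (λ v → Σ (Normalisation u) (λ nu → Σ (Normalisation v) (λ nv →
       TilingEquiv m (tilingOf nu nv))))))
theorem5p20 =
    (λ u v nu nv → ∧-tiling-tame (vectors nu) (vectors nv) (vectors-unimodular nu) (vectors-unimodular nv))
  , (λ u v u′ v′ → tilingOf-SL₂-invariant)
  , (λ u v u′ v′ → tilingOf-injective)
  , surjective
  where
  surjective : (m : ℤ → ℤ → 𝔼) → TameTiling m →
    Σ Path λ u → Σ Path λ v → Σ (Normalisation u) λ nu → Σ (Normalisation v) λ nv →
      TilingEquiv m (tilingOf nu nv)
  surjective m m-tame =
    let x , w , x-unimodular , w-unimodular , ∧≡m = tame-tiling-factorisation m m-tame in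
    path-through x x-unimodular , path-through w w-unimodular ,
    path-normalisation x x-unimodular , path-normalisation w w-unimodular ,
    pointwise⇒TilingEquiv m (∧-tiling x w) ∧≡m
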